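{- The optimised algorithm is a non-deterministic decision procedure for satisfiability of $\mathbf{Gr}(\mathbf{K}_\mathcal{R})$-formulae in negation normal form: for every such formula $\phi$, every sequence of optimised rule applications starting from $\{x_0\models\phi\}$ is finite, and $\phi$ is satisfiable iff some such sequence results in a complete and clash-free constraint system.
   Context: Formulae in NNF: $p$, $\neg p$, $\psi_1\wedge\psi_2$, $\psi_1\vee\psi_2$, $\langle R\rangle_{\ge n}\psi$, $\langle R\rangle_{\le n}\psi$ (at least / at most $n$ $R$-successors satisfy $\psi$). $\sim\psi$ is the NNF of $\neg\psi$ (De Morgan, $\neg\langle R\rangle_{\ge 0}\psi\equiv p\wedge\neg p$, $\neg\langle R\rangle_{\ge n}\psi\equiv\langle R\rangle_{\le n-1}\psi$ for $n\ge1$, $\neg\langle R\rangle_{\le n}\psi\equiv\langle R\rangle_{\ge n+1}\psi$). A constraint system (c.s.) is a finite set of expressions $x\models\psi$ and $Rxy$ over variables; $\sharp R^S(x,\psi)=|\{y:\{Rxy,y\models\psi\}\subseteq S\}|$. Optimised rules: ($\wedge$) if $x\models\psi_1\wedge\psi_2\in S$ and not both $x\models\psi_1,x\models\psi_2\in S$, add both; ($\vee$) if $x\models\psi_1\vee\psi_2\in S$ and neither disjunct constraint is in $S$, add $x\models\chi$ for a chosen $\chi\in\{\psi_1,\psi_2\}$; ($\ge$) if $x\models\langle R\rangle_{\ge n}\psi\in S$, $\sharp R^S(x,\psi)<n$, and neither the $\wedge$- nor $\vee$-rule applies to a constraint for $x$, add $Rxy$, $y\models\psi$, $y\models\chi_1,\dots,y\models\chi_k$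 for a fresh $y$, where $\{\psi_1,\dots,\psi_k\}=\{\psi':x\models\langle R\rangle_{\bowtie m}\psi'\in S,\ \bowtie\in\{\le,\ge\}\}$ and each $\chi_i\in\{\psi_i,\sim\psi_i\}$ chosen nondeterministically. A c.s. is complete if no rule applies. It contains a clash if $\{x\models p,x\models\neg p\}\subseteq S$ for some $x$ and atom $p$, or $x\models\langle R\rangle_{\le n}\psi\in S$ and $\sharp R^S(x,\psi)>n$; otherwise it is clash-free. -}

module Defs where

open import Data.Nat using (ℕ; zero; suc)
open import Data.Fin using (Fin)
open import Data.Bool using (Bool; true; false; if_then_else_)
open import Data.Product using (Σ; Σ-syntax; ∃; ∃-syntax; _×_; _,_)
open import Data.Sum using (_⊎_)
open import Data.Empty using (⊥)
open import Data.List using (List; []; _∷_; _++_)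
open import Data.List.Membership.Propositional using (_∈_; _∉_)
open import Data.List.Relation.Unary.Any using (Any)
open import Relation.Nullary using (¬_)
open import Relation.Binary.PropositionalEquality using (_≡_)
open import Relation.Binary.Construct.Closure.ReflexiveTransitive using (Star)
open import Function.Definitions using (Injective)

Atom : Set
Atom = ℕ

Rel : Set
Rel = ℕ

data Form : Set where
  atom  : Atom → Form
  natom : Atom → Form
  _∧f_  : Form → Form → Form
  _∨f_  : Form → Form → Form
  ⟨_⟩≥_∙_ : Rel → ℕ → Form → Form
  ⟨_⟩≤_∙_ : Rel → ℕ → Form → Form

-- ∼ψ : NNF of ¬ψ.  ¬⟨R⟩_{≥0}ψ ≡ p ∧ ¬p, with p fixed to atom 0.
∼_ : Form → Form
∼ atom p = natom p
∼ natom p = atom p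
∼ (ψ₁ ∧f ψ₂) = (∼ ψ₁) ∨f (∼ ψ₂)
∼ (ψ₁ ∨f ψ₂) = (∼ ψ₁) ∧f (∼ ψ₂)
∼ (⟨ R ⟩≥ zero ∙ ψ) = atom 0 ∧f natom 0
∼ (⟨ R ⟩≥ suc n ∙ ψ) = ⟨ R ⟩≤ n ∙ ψ
∼ (⟨ R ⟩≤ n ∙ ψ) = ⟨ R ⟩≥ suc n ∙ ψ

record Model : Set₁ where
  field
    W   : Set
    acc : Rel → W → W → Set
    val : Atom → W → Set

open Model

AtLeastM : (M : Model) → Rel → W M → (W M → Set) → ℕ → Set
AtLeastM M R w P n =
  Σ[ f ∈ (Fin n → W M) ] (Injective _≡_ _≡_ f × (∀ i → acc M R w (f i) × P (f i)))

_,_⊨_ : (M : Model) → W M → Form → Set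
M , w ⊨ atom p = val M p w
M , w ⊨ natom p = ¬ val M p w
M , w ⊨ (ψ₁ ∧f ψ₂) = (M , w ⊨ ψ₁) × (M , w ⊨ ψ₂)
M , w ⊨ (ψ₁ ∨f ψ₂) = (M , w ⊨ ψ₁) ⊎ (M , w ⊨ ψ₂)
M , w ⊨ (⟨ R ⟩≥ n ∙ ψ) = AtLeastM M R w (λ v → M , v ⊨ ψ) n
M , w ⊨ (⟨ R ⟩≤ n ∙ ψ) = ¬ AtLeastM M R w (λ v → M , v ⊨ ψ) (suc n)

Satisfiable : Form → Set₁
Satisfiable φ = Σ[ M ∈ Model ] Σ[ w ∈ W M ] (M , w ⊨ φ)

-- Constraint systems.  Variables are natural numbers; a c.s. is a finite
-- set of constraints, represented by a list (only membership matters).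

Var : Set
Var = ℕ

data Constraint : Set where
  _⊨c_ : Var → Form → Constraint
  rel  : Rel → Var → Var → Constraint

CS : Set
CS = List Constraint

AtLeastS : CS → Rel → Var → Form → ℕ → Set
AtLeastS S R x ψ k =
  Σ[ f ∈ (Fin k → Var) ]
    (Injective _≡_ _≡_ f × (∀ i → (rel R x (f i) ∈ S) × ((f i ⊨c ψ) ∈ S)))

OccursC : Var → Constraint → Set
OccursC y (x ⊨c ψ) = y ≡ x
OccursC y (rel R x z) = (y ≡ x) ⊎ (y ≡ z)

Occurs : Var → CS → Set
Occurs y S = Any (OccursC y) S

∧Applies : CS → Var → Set
∧Applies S x = Σ[ ψ₁ ∈ Form ] Σ[ ψ₂ ∈ Form ]
  (((x ⊨c (ψ₁ ∧f ψ₂)) ∈ S) × ¬ (((x ⊨c ψ₁) ∈ S) × ((x ⊨c ψ₂) ∈ S)))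

∨Applies : CS → Var → Set
∨Applies S x = Σ[ ψ₁ ∈ Form ] Σ[ ψ₂ ∈ Form ]
  (((x ⊨c (ψ₁ ∨f ψ₂)) ∈ S) × ((x ⊨c ψ₁) ∉ S) × ((x ⊨c ψ₂) ∉ S))

InModalSet : CS → Rel → Var → Form → Set
InModalSet S R x ψ' =
  Σ[ m ∈ ℕ ] (((x ⊨c (⟨ R ⟩≥ m ∙ ψ')) ∈ S) ⊎ ((x ⊨c (⟨ R ⟩≤ m ∙ ψ')) ∈ S))

select : (Form → Bool) → Form → Form
select ch ψ' = if ch ψ' then ψ' else ∼ ψ'

data Step (S : CS) : CS → Set where
  ∧-rule : ∀ x ψ₁ ψ₂ →
    (x ⊨c (ψ₁ ∧f ψ₂)) ∈ S →
    ¬ (((x ⊨c ψ₁) ∈ S) × ((x ⊨c ψ₂) ∈ S)) →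
    Step S ((x ⊨c ψ₁) ∷ (x ⊨c ψ₂) ∷ S)
  ∨-rule : ∀ x ψ₁ ψ₂ χ →
    (x ⊨c (ψ₁ ∨f ψ₂)) ∈ S →
    (x ⊨c ψ₁) ∉ S → (x ⊨c ψ₂) ∉ S →
    (χ ≡ ψ₁) ⊎ (χ ≡ ψ₂) →
    Step S ((x ⊨c χ) ∷ S)
  ≥-rule : ∀ x R n ψ y (ch : Form → Bool) (L : CS) →
    (x ⊨c (⟨ R ⟩≥ n ∙ ψ)) ∈ S →
    ¬ AtLeastS S R x ψ n →
    ¬ ∧Applies S x → ¬ ∨Applies S x →
    ¬ Occurs y S →
    -- L = { y ⊨ χᵢ }, one chosen χᵢ ∈ {ψᵢ, ∼ψᵢ} per ψᵢ in the modal set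
    (∀ c → c ∈ L → Σ[ ψ' ∈ Form ] (InModalSet S R x ψ' × (c ≡ (y ⊨c select ch ψ')))) →
    (∀ ψ' → InModalSet S R x ψ' → (y ⊨c select ch ψ') ∈ L) →
    Step S (rel R x y ∷ (y ⊨c ψ) ∷ L ++ S)

Complete : CS → Set
Complete S = ∀ S' → ¬ Step S S'

Clash : CS → Set
Clash S =
  (Σ[ x ∈ Var ] Σ[ p ∈ Atom ] (((x ⊨c atom p) ∈ S) × ((x ⊨c natom p) ∈ S)))
  ⊎ (Σ[ x ∈ Var ] Σ[ R ∈ Rel ] Σ[ n ∈ ℕ ] Σ[ ψ ∈ Form ]
       (((x ⊨c (⟨ R ⟩≤ n ∙ ψ)) ∈ S) × AtLeastS S R x ψ (suc n)))

ClashFree : CS → Set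
ClashFree S = ¬ Clash S

x₀ : Var
x₀ = 0

initial : Form → CS
initial φ = (x₀ ⊨c φ) ∷ []

NoInfiniteRun : CS → Set
NoInfiniteRun S = ¬ (Σ[ f ∈ (ℕ → CS) ] ((f 0 ≡ S) × (∀ i → Step (f i) (f (suc i)))))

Step* : CS → CS → Set
Step* = Star Step

-- Every formula occurring in a run from {x₀ ⊨ φ} lies in the finite closure Cl of φ,
-- formed by the subformulae of ψ and of ∼ ψ for the subformulae ψ of φ.  Give a variable z the cost
--   #(formulae of Cl not yet at z) + weight (depth z) · Σ_{⟨R⟩≥n ψ ∈ Cl} (n ∸ ♯R(z, ψ)).
-- The ∧- and ∨-rules lower the first summand at one variable; the ≥-rule lowers the second one at x
-- by weight (depth x), which exceeds the whole cost of the new, shallower successor.  So the total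
-- cost decreases strictly along every run.
--
-- A complete clash-free system is a model of its formulae, with the variables as worlds.
-- The optimised ≥-rule fires only at propositionally saturated variables and gives each new successor
-- ψ′ or ∼ψ′ for every ψ′ under a counting modality at its source, so every R-successor of x decides
-- these formulae; this is why the syntactic clash condition for ⟨R⟩≤n ψ suffices.
--
-- Explore all branches of rule applications, which is possible by termination.  A model
-- into which a system embeds also admits an embedding of one of its successors: for the ≥-rule, one of
-- the n witnesses of ⟨R⟩≥n ψ is not yet the image of a successor, and the choices χᵢ are read off it.
-- This is classical reasoning, harmless because it only serves to refute the existence of a model.

module Submission where

open import Defs
open Model
open import Data.Product using (Σ-syntax; _×_)
open import Data.Product using (Σ; _,_; proj₁; proj₂; ∃-syntax)
open import Data.Nat using (ℕ; zero; suc; _+_; _*_; _∸_; _≤_; _<_; _⊔_; z≤n; s≤s; _≤?_)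
open import Data.Nat.Properties
open import Data.Fin using (Fin; zero; suc; inject≤)
open import Data.Fin.Properties using (injective⇒≤; inject≤-injective)
open import Data.List using (List; []; _∷_; _++_; map; concatMap; length; lookup; filter; upTo; allFin)
open import Data.Nat.ListAction using (sum)
open import Data.List.Relation.Unary.Any as Any using (Any; here; there; any?; index)
open import Data.List.Relation.Unary.Any.Properties using (lookup-index)
open import Data.List.Relation.Unary.All as All using (All; []; _∷_)
import Data.List.Relation.Unary.All.Properties as AllP
open import Data.List.Extrema.Nat using (max; v≤max⁺; max≤v⁺; max<v⁺)
open import Data.List.Relation.Unary.AllPairs using (_∷_)
open import Data.List.Relation.Unary.Unique.Propositional using (Unique)
open import Data.List.Relation.Unary.Unique.Propositional.Properties using (upTo⁺; filter⁺)
open import Data.List.Relation.Binary.Subset.Propositional using (_⊆_)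
open import Data.List.Membership.Propositional using (_∈_; _∉_; find; lose)
open import Data.List.Membership.Propositional.Properties using (∈-lookup; ∈-filter⁺; ∈-filter⁻; ∈-upTo⁺; ∈-concatMap⁺; ∈-concatMap⁻; ∈-++⁺ˡ; ∈-++⁺ʳ; ∈-++⁻; ∈-map⁺; ∈-map⁻; ∈-allFin)
open import Data.Sum as Sum using (_⊎_; inj₁; inj₂)
open import Data.Bool using (Bool; true; false)
open import Data.Empty using (⊥; ⊥-elim)
open import Relation.Nullary using (¬_; Dec; yes; no; map′; ¬?; _×-dec_; _⊎-dec_)
open import Relation.Binary.Construct.Closure.ReflexiveTransitive using (ε; _◅_)
open import Relation.Binary.Definitions using (DecidableEquality)
open import Relation.Binary.PropositionalEquality using (_≡_; _≢_; refl; sym; trans; cong; cong₂; subst; subst₂; module ≡-Reasoning)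
open import Algebra.Properties.CommutativeSemigroup +-commutativeSemigroup using (x∙yz≈y∙xz)
open import Function.Definitions using (Injective)
open import Function using (_∘_; _on_; case_of_)
import Relation.Binary.Construct.On as On
open import Induction.InfiniteDescent using (Descent; descent∧wf⇒empty)
open import Data.Nat.Induction using (<-wellFounded)
open import Induction.WellFounded using (Acc) renaming (acc to acc-intro)

private
  variable
    A B : Set
    n : ℕ
    x y : Var
    R : Rel
    ψ χ φ a b : Form
    S S′ : CS

lookup-injective : {xs : List A} → Unique xs → Injective _≡_ _≡_ (lookup xs)
lookup-injective {xs = _ ∷ _} _ {zero} {zero} _ = refl
lookup-injective {xs = _ ∷ _} (_ ∷ u) {suc i} {suc j} e = cong suc (lookup-injective u e)
lookup-injective {xs = _ ∷ _} (x∉ ∷ _) {zero} {suc j} e = ⊥-elim (All.lookup x∉ (∈-lookup j) e)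
lookup-injective {xs = _ ∷ _} (x∉ ∷ _) {suc i} {zero} e = ⊥-elim (All.lookup x∉ (∈-lookup i) (sym e))

injective-cover⇒≤length : {xs : List B} (h : B → A) (f : Fin n → A) → Injective _≡_ _≡_ f →
  (∀ i → Any (λ u → f i ≡ h u) xs) → n ≤ length xs
injective-cover⇒≤length {xs = xs} h f f-inj cover = injective⇒≤ {f = position} position-injective
  where
  position : Fin _ → Fin (length xs)
  position i = index (cover i)

  position-injective : Injective _≡_ _≡_ position
  position-injective {i} {j} e =
    f-inj (trans (lookup-index (cover i)) (trans (cong (h ∘ lookup xs) e) (sym (lookup-index (cover j)))))

unique⇒injective-members : {xs : List A} → Unique xs → n ≤ length xs →
  Σ[ f ∈ (Fin n → A) ] (Injective _≡_ _≡_ f × (∀ i → f i ∈ xs))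
unique⇒injective-members {xs = xs} u n≤ =
  (λ i → lookup xs (inject≤ i n≤)) ,
  (λ e → inject≤-injective n≤ n≤ _ _ (lookup-injective u e)) ,
  (λ i → ∈-lookup (inject≤ i n≤))

unique-⊆⇒length≤ : {xs ys : List A} → Unique xs → xs ⊆ ys → length xs ≤ length ys
unique-⊆⇒length≤ {xs = xs} u xs⊆ys =
  injective-cover⇒≤length (λ a → a) (lookup xs) (lookup-injective u) (xs⊆ys ∘ ∈-lookup)

¬¬-all : {P : A → Set} (xs : List A) → (∀ {a} → a ∈ xs → ¬ ¬ P a) → ¬ ¬ (∀ {a} → a ∈ xs → P a)
¬¬-all [] _ k = k λ ()
¬¬-all (a ∷ xs) ¬¬P k = ¬¬P (here refl) λ Pa → ¬¬-all xs (¬¬P ∘ there) λ Pxs →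
  k λ { (here refl) → Pa ; (there a∈xs) → Pxs a∈xs }

¬¬-uncovered : (π : B → A) (xs : List B) (g : Fin n → A) → Injective _≡_ _≡_ g → length xs < n →
  ¬ ¬ (∃[ i ] ∀ {u} → u ∈ xs → π u ≢ g i)
¬¬-uncovered {n = n} π xs g g-inj xs<n no-i =
  ¬¬-all (allFin n) (λ {i} _ uncovered → no-i (i , λ u∈ πu≡gi → uncovered (lose u∈ (sym πu≡gi))))
    λ covered → <⇒≱ xs<n (injective-cover⇒≤length π g g-inj (covered ∘ ∈-allFin))

module _ (_≟_ : DecidableEquality A) where

  override : A → Bool → (A → Bool) → A → Bool
  override a b f z with z ≟ a
  ... | yes _ = b
  ... | no _ = f z

  boolFunctions : List A → List (A → Bool)
  boolFunctions [] = (λ _ → true) ∷ []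
  boolFunctions (a ∷ as) = concatMap (λ f → override a true f ∷ override a false f ∷ []) (boolFunctions as)

  boolFunctions-complete : (Q : A → Bool → Set) (as : List A) → (∀ {a} → a ∈ as → Σ Bool (Q a)) →
    Σ[ f ∈ (A → Bool) ] (f ∈ boolFunctions as × (∀ {a} → a ∈ as → Q a (f a)))
  boolFunctions-complete Q [] _ = (λ _ → true) , here refl , λ ()
  boolFunctions-complete Q (a ∷ as) choice
    with bit , Qa ← choice (here refl)
       | f , f∈ , f-agrees ← boolFunctions-complete Q as (choice ∘ there)
    = override a bit f , ∈-concatMap⁺ _ {xs = boolFunctions as} (lose f∈ (overrides∋ bit)) , agrees
    where
    overrides∋ : ∀ b → override a b f ∈ override a true f ∷ override a false f ∷ []
    overrides∋ true = here refl
    overrides∋ false = there (here refl)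

    agrees : ∀ {z} → z ∈ a ∷ as → Q z (override a bit f z)
    agrees {z} z∈ with z ≟ a | z∈
    ... | yes refl | _ = Qa
    ... | no z≢a | here refl = ⊥-elim (z≢a refl)
    ... | no _ | there z∈as = f-agrees z∈as

any-or-all : ∀ {p q} {P : A → Set p} {Q : A → Set q} → (∀ a → P a ⊎ Q a) → ∀ xs → Any P xs ⊎ All Q xs
any-or-all P⊎Q [] = inj₂ []
any-or-all P⊎Q (a ∷ xs) with P⊎Q a | any-or-all P⊎Q xs
... | inj₁ Pa | _ = inj₁ (here Pa)
... | inj₂ _ | inj₁ any = inj₁ (there any)
... | inj₂ Qa | inj₂ all = inj₂ (Qa ∷ all)

≡-either : ∀ (P : A → Set) {x a b} → (x ≡ a) ⊎ (x ≡ b) → P a → P b → P x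
≡-either P (inj₁ refl) pa _ = pa
≡-either P (inj₂ refl) _ pb = pb

sumBelow : ℕ → (ℕ → ℕ) → ℕ
sumBelow zero f = 0
sumBelow (suc n) f = f n + sumBelow n f

_without_ : (ℕ → ℕ) → ℕ → ℕ → ℕ
(f without x) z with z ≟ x
... | yes _ = 0
... | no _ = f z

without-≢ : ∀ (f : ℕ → ℕ) {x z} → z ≢ x → (f without x) z ≡ f z
without-≢ f {x} {z} z≢x with z ≟ x
... | yes z≡x = ⊥-elim (z≢x z≡x)
... | no _ = refl

sumBelow-cong : ∀ n {f g : ℕ → ℕ} → (∀ {z} → z < n → f z ≡ g z) → sumBelow n f ≡ sumBelow n g
sumBelow-cong zero _ = refl
sumBelow-cong (suc n) f≡g = cong₂ _+_ (f≡g ≤-refl) (sumBelow-cong n (f≡g ∘ m≤n⇒m≤1+n))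

sumBelow-mono : ∀ n {f g : ℕ → ℕ} → (∀ z → f z ≤ g z) → sumBelow n f ≤ sumBelow n g
sumBelow-mono zero _ = z≤n
sumBelow-mono (suc n) f≤g = +-mono-≤ (f≤g n) (sumBelow-mono n f≤g)

sumBelow-zeros : ∀ {m n} {f : ℕ → ℕ} → (∀ {z} → m ≤ z → f z ≡ 0) → m ≤ n → sumBelow n f ≡ sumBelow m f
sumBelow-zeros {m} {n} {f} vanish m≤n = go (n ∸ m) n (m∸n+n≡m m≤n)
  where
  go : ∀ k n → k + m ≡ n → sumBelow n f ≡ sumBelow m f
  go zero n refl = refl
  go (suc k) n refl = cong₂ _+_ (vanish (m≤n+m m k)) (go k (k + m) refl)

sumBelow-remove : ∀ n {x} (f : ℕ → ℕ) → x < n → sumBelow n f ≡ f x + sumBelow n (f without x)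
sumBelow-remove (suc n) {x} f x<1+n with n ≟ x
... | yes refl = cong (f n +_) (sumBelow-cong n (λ z<n → sym (without-≢ f (<⇒≢ z<n))))
... | no n≢x = begin
  f n + sumBelow n f                          ≡⟨ cong (f n +_) (sumBelow-remove n f (≤∧≢⇒< (≤-pred x<1+n) (n≢x ∘ sym))) ⟩
  f n + (f x + sumBelow n (f without x))      ≡⟨ x∙yz≈y∙xz (f n) (f x) _ ⟩
  f x + (f n + sumBelow n (f without x))      ∎
  where open ≡-Reasoning

sumBelow-<₁ : ∀ n {x} {f g : ℕ → ℕ} → x < n → (∀ z → z ≢ x → f z ≤ g z) → f x < g x → sumBelow n f < sumBelow n g
sumBelow-<₁ n {x} {f} {g} x<n f≤g fx<gx = begin-strict
  sumBelow n f                    ≡⟨ sumBelow-remove n f x<n ⟩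
  f x + sumBelow n (f without x)  <⟨ +-mono-<-≤ fx<gx (sumBelow-mono n rest≤) ⟩
  g x + sumBelow n (g without x)  ≡⟨ sumBelow-remove n g x<n ⟨
  sumBelow n g                    ∎
  where
  open ≤-Reasoning
  rest≤ : ∀ z → (f without x) z ≤ (g without x) z
  rest≤ z with z ≟ x
  ... | yes _ = z≤n
  ... | no z≢x = f≤g z z≢x

sumBelow-<₂ : ∀ n {x y} {f g : ℕ → ℕ} → x < n → y < n → x ≢ y →
  (∀ z → z ≢ x → z ≢ y → f z ≤ g z) → f x + f y < g x + g y → sumBelow n f < sumBelow n g
sumBelow-<₂ n {x} {y} {f} {g} x<n y<n x≢y f≤g fxy<gxy = begin-strict
  sumBelow n f                                  ≡⟨ remove₂ f ⟩
  f x + f y + sumBelow n ((f without x) without y)  <⟨ +-mono-<-≤ fxy<gxy (sumBelow-mono n rest≤) ⟩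
  g x + g y + sumBelow n ((g without x) without y)  ≡⟨ remove₂ g ⟨
  sumBelow n g                                  ∎
  where
  open ≤-Reasoning
  remove₂ : ∀ h → sumBelow n h ≡ h x + h y + sumBelow n ((h without x) without y)
  remove₂ h = begin-equality
    sumBelow n h                                            ≡⟨ sumBelow-remove n h x<n ⟩
    h x + sumBelow n (h without x)                          ≡⟨ cong (h x +_) (sumBelow-remove n (h without x) y<n) ⟩
    h x + ((h without x) y + sumBelow n ((h without x) without y))
      ≡⟨ cong (λ v → h x + (v + sumBelow n ((h without x) without y))) (without-≢ h (x≢y ∘ sym)) ⟩
    h x + (h y + sumBelow n ((h without x) without y))      ≡⟨ +-assoc (h x) (h y) _ ⟨
    h x + h y + sumBelow n ((h without x) without y)        ∎
  rest≤ : ∀ z → ((f without x) without y) z ≤ ((g without x) without y) z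
  rest≤ z with z ≟ y
  ... | yes _ = z≤n
  ... | no z≢y with z ≟ x
  ...   | yes _ = z≤n
  ...   | no z≢x = f≤g z z≢x z≢y

sum-map-mono : ∀ (xs : List A) {f g : A → ℕ} → (∀ a → f a ≤ g a) → sum (map f xs) ≤ sum (map g xs)
sum-map-mono [] _ = z≤n
sum-map-mono (a ∷ xs) f≤g = +-mono-≤ (f≤g a) (sum-map-mono xs f≤g)

sum-map-< : ∀ (xs : List A) {f g : A → ℕ} {a} → (∀ a → f a ≤ g a) → a ∈ xs → f a < g a →
  sum (map f xs) < sum (map g xs)
sum-map-< (a ∷ xs) f≤g (here refl) fa<ga = +-mono-<-≤ fa<ga (sum-map-mono xs f≤g)
sum-map-< (b ∷ xs) f≤g (there a∈xs) fa<ga = +-mono-≤-< (f≤g b) (sum-map-< xs f≤g a∈xs fa<ga)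

sum-map-≤1 : ∀ (xs : List A) {f : A → ℕ} → (∀ a → f a ≤ 1) → sum (map f xs) ≤ length xs
sum-map-≤1 [] _ = z≤n
sum-map-≤1 (a ∷ xs) f≤1 = +-mono-≤ (f≤1 a) (sum-map-≤1 xs f≤1)

infix 4 _≟ᶠ_

_≟ᶠ_ : DecidableEquality Form
atom p ≟ᶠ atom q = map′ (cong atom) (λ { refl → refl }) (p ≟ q)
natom p ≟ᶠ natom q = map′ (cong natom) (λ { refl → refl }) (p ≟ q)
(a ∧f b) ≟ᶠ (c ∧f d) =
  map′ (λ { (refl , refl) → refl }) (λ { refl → refl , refl }) (a ≟ᶠ c ×-dec b ≟ᶠ d)
(a ∨f b) ≟ᶠ (c ∨f d) =
  map′ (λ { (refl , refl) → refl }) (λ { refl → refl , refl }) (a ≟ᶠ c ×-dec b ≟ᶠ d)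
(⟨ R ⟩≥ n ∙ a) ≟ᶠ (⟨ R′ ⟩≥ m ∙ c) =
  map′ (λ { (refl , refl , refl) → refl }) (λ { refl → refl , refl , refl }) (R ≟ R′ ×-dec n ≟ m ×-dec a ≟ᶠ c)
(⟨ R ⟩≤ n ∙ a) ≟ᶠ (⟨ R′ ⟩≤ m ∙ c) =
  map′ (λ { (refl , refl , refl) → refl }) (λ { refl → refl , refl , refl }) (R ≟ R′ ×-dec n ≟ m ×-dec a ≟ᶠ c)
atom _ ≟ᶠ natom _ = no λ ()
atom _ ≟ᶠ (_ ∧f _) = no λ ()
atom _ ≟ᶠ (_ ∨f _) = no λ ()
atom _ ≟ᶠ (⟨ _ ⟩≥ _ ∙ _) = no λ ()
atom _ ≟ᶠ (⟨ _ ⟩≤ _ ∙ _) = no λ ()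
natom _ ≟ᶠ atom _ = no λ ()
natom _ ≟ᶠ (_ ∧f _) = no λ ()
natom _ ≟ᶠ (_ ∨f _) = no λ ()
natom _ ≟ᶠ (⟨ _ ⟩≥ _ ∙ _) = no λ ()
natom _ ≟ᶠ (⟨ _ ⟩≤ _ ∙ _) = no λ ()
(_ ∧f _) ≟ᶠ atom _ = no λ ()
(_ ∧f _) ≟ᶠ natom _ = no λ ()
(_ ∧f _) ≟ᶠ (_ ∨f _) = no λ ()
(_ ∧f _) ≟ᶠ (⟨ _ ⟩≥ _ ∙ _) = no λ ()
(_ ∧f _) ≟ᶠ (⟨ _ ⟩≤ _ ∙ _) = no λ ()
(_ ∨f _) ≟ᶠ atom _ = no λ ()
(_ ∨f _) ≟ᶠ natom _ = no λ ()
(_ ∨f _) ≟ᶠ (_ ∧f _) = no λ ()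
(_ ∨f _) ≟ᶠ (⟨ _ ⟩≥ _ ∙ _) = no λ ()
(_ ∨f _) ≟ᶠ (⟨ _ ⟩≤ _ ∙ _) = no λ ()
(⟨ _ ⟩≥ _ ∙ _) ≟ᶠ atom _ = no λ ()
(⟨ _ ⟩≥ _ ∙ _) ≟ᶠ natom _ = no λ ()
(⟨ _ ⟩≥ _ ∙ _) ≟ᶠ (_ ∧f _) = no λ ()
(⟨ _ ⟩≥ _ ∙ _) ≟ᶠ (_ ∨f _) = no λ ()
(⟨ _ ⟩≥ _ ∙ _) ≟ᶠ (⟨ _ ⟩≤ _ ∙ _) = no λ ()
(⟨ _ ⟩≤ _ ∙ _) ≟ᶠ atom _ = no λ ()
(⟨ _ ⟩≤ _ ∙ _) ≟ᶠ natom _ = no λ ()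
(⟨ _ ⟩≤ _ ∙ _) ≟ᶠ (_ ∧f _) = no λ ()
(⟨ _ ⟩≤ _ ∙ _) ≟ᶠ (_ ∨f _) = no λ ()
(⟨ _ ⟩≤ _ ∙ _) ≟ᶠ (⟨ _ ⟩≥ _ ∙ _) = no λ ()

md : Form → ℕ
md (atom _) = 0
md (natom _) = 0
md (a ∧f b) = md a ⊔ md b
md (a ∨f b) = md a ⊔ md b
md (⟨ _ ⟩≥ _ ∙ a) = suc (md a)
md (⟨ _ ⟩≤ _ ∙ a) = suc (md a)

md-∼ : ∀ ψ → md (∼ ψ) ≤ md ψ
md-∼ (atom _) = ≤-refl
md-∼ (natom _) = ≤-refl
md-∼ (a ∧f b) = ⊔-mono-≤ (md-∼ a) (md-∼ b)
md-∼ (a ∨f b) = ⊔-mono-≤ (md-∼ a) (md-∼ b)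
md-∼ (⟨ _ ⟩≥ zero ∙ _) = z≤n
md-∼ (⟨ _ ⟩≥ suc _ ∙ _) = ≤-refl
md-∼ (⟨ _ ⟩≤ _ ∙ _) = ≤-refl

select-elim : ∀ (P : Form → Set) ch {ψ} → P ψ → P (∼ ψ) → P (select ch ψ)
select-elim P ch {ψ} p q with ch ψ
... | true = p
... | false = q

md-select : ∀ ch ψ → md (select ch ψ) ≤ md ψ
md-select ch ψ = select-elim (λ χ → md χ ≤ md ψ) ch ≤-refl (md-∼ ψ)

mutual
  subformulas : Form → List Form
  subformulas φ = φ ∷ properSubformulas φ

  properSubformulas : Form → List Form
  properSubformulas (a ∧f b) = subformulas a ++ subformulas b
  properSubformulas (a ∨f b) = subformulas a ++ subformulas b
  properSubformulas (⟨ _ ⟩≥ _ ∙ a) = subformulas a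
  properSubformulas (⟨ _ ⟩≤ _ ∙ a) = subformulas a
  properSubformulas _ = []

mutual
  subformula-trans : χ ∈ subformulas ψ → ψ ∈ subformulas φ → χ ∈ subformulas φ
  subformula-trans χ∈ (here refl) = χ∈
  subformula-trans {φ = φ} χ∈ (there ψ∈) = there (proper-trans φ χ∈ ψ∈)

  proper-trans : ∀ φ → χ ∈ subformulas ψ → ψ ∈ properSubformulas φ → χ ∈ properSubformulas φ
  proper-trans (a ∧f b) χ∈ ψ∈ = ++-trans a b χ∈ ψ∈
  proper-trans (a ∨f b) χ∈ ψ∈ = ++-trans a b χ∈ ψ∈
  proper-trans (⟨ _ ⟩≥ _ ∙ a) χ∈ ψ∈ = subformula-trans χ∈ ψ∈
  proper-trans (⟨ _ ⟩≤ _ ∙ a) χ∈ ψ∈ = subformula-trans χ∈ ψ∈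

  ++-trans : ∀ a b → χ ∈ subformulas ψ → ψ ∈ subformulas a ++ subformulas b → χ ∈ subformulas a ++ subformulas b
  ++-trans a b χ∈ ψ∈ with ∈-++⁻ (subformulas a) ψ∈
  ... | inj₁ ψ∈a = ∈-++⁺ˡ (subformula-trans χ∈ ψ∈a)
  ... | inj₂ ψ∈b = ∈-++⁺ʳ (subformulas a) (subformula-trans χ∈ ψ∈b)

data ModalOver (a : Form) : Form → Set where
  ≥-over : ∀ {R n} → ModalOver a (⟨ R ⟩≥ n ∙ a)
  ≤-over : ∀ {R n} → ModalOver a (⟨ R ⟩≤ n ∙ a)

modalOver-subformula : ModalOver a χ → a ∈ subformulas χ
modalOver-subformula ≥-over = there (here refl)
modalOver-subformula ≤-over = there (here refl)

mutual
  modalOver-∼ : ∀ ψ → ModalOver a χ → χ ∈ subformulas (∼ ψ) → a ∈ subformulas ψ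
  modalOver-∼ (atom _) () (here refl)
  modalOver-∼ (natom _) () (here refl)
  modalOver-∼ (_ ∧f _) () (here refl)
  modalOver-∼ (b ∧f c) o (there χ∈) = there (++-∼ b c o χ∈)
  modalOver-∼ (_ ∨f _) () (here refl)
  modalOver-∼ (b ∨f c) o (there χ∈) = there (++-∼ b c o χ∈)
  modalOver-∼ (⟨ _ ⟩≥ zero ∙ _) () (here refl)
  modalOver-∼ (⟨ _ ⟩≥ zero ∙ _) () (there (here refl))
  modalOver-∼ (⟨ _ ⟩≥ zero ∙ _) () (there (there (here refl)))
  modalOver-∼ (⟨ _ ⟩≥ suc _ ∙ _) ≤-over (here refl) = there (here refl)
  modalOver-∼ (⟨ _ ⟩≥ suc _ ∙ _) o (there χ∈) = there (subformula-trans (modalOver-subformula o) χ∈)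
  modalOver-∼ (⟨ _ ⟩≤ _ ∙ _) ≥-over (here refl) = there (here refl)
  modalOver-∼ (⟨ _ ⟩≤ _ ∙ _) o (there χ∈) = there (subformula-trans (modalOver-subformula o) χ∈)

  ++-∼ : ∀ b c → ModalOver a χ → χ ∈ subformulas (∼ b) ++ subformulas (∼ c) → a ∈ subformulas b ++ subformulas c
  ++-∼ b c o χ∈ with ∈-++⁻ (subformulas (∼ b)) χ∈
  ... | inj₁ χ∈b = ∈-++⁺ˡ (modalOver-∼ b o χ∈b)
  ... | inj₂ χ∈c = ∈-++⁺ʳ (subformulas b) (modalOver-∼ c o χ∈c)

record Closed (Cl : List Form) : Set where
  field
    subformula-closed : ∀ {a χ} → χ ∈ Cl → a ∈ subformulas χ → a ∈ Cl
    ∼-closed : ∀ {a χ} → ModalOver a χ → χ ∈ Cl → ∼ a ∈ Cl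

  ∧-closed : ∀ {a b} → (a ∧f b) ∈ Cl → a ∈ Cl × b ∈ Cl
  ∧-closed {a} m = subformula-closed m (there (here refl)) , subformula-closed m (there (∈-++⁺ʳ (subformulas a) (here refl)))

  ∨-closed : ∀ {a b} → (a ∨f b) ∈ Cl → a ∈ Cl × b ∈ Cl
  ∨-closed {a} m = subformula-closed m (there (here refl)) , subformula-closed m (there (∈-++⁺ʳ (subformulas a) (here refl)))

  modal-closed : ∀ {a χ} → ModalOver a χ → χ ∈ Cl → a ∈ Cl × ∼ a ∈ Cl
  modal-closed o χ∈ = subformula-closed χ∈ (modalOver-subformula o) , ∼-closed o χ∈

±subformulas : Form → List Form
±subformulas ψ = subformulas ψ ++ subformulas (∼ ψ)

closure : Form → List Form
closure φ = concatMap ±subformulas (subformulas φ)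

closure⁺ : ψ ∈ subformulas φ → χ ∈ ±subformulas ψ → χ ∈ closure φ
closure⁺ {φ = φ} ψ∈ χ∈ = ∈-concatMap⁺ ±subformulas {xs = subformulas φ} (lose ψ∈ χ∈)

closure⁻ : χ ∈ closure φ → ∃[ ψ ] (ψ ∈ subformulas φ × χ ∈ ±subformulas ψ)
closure⁻ {φ = φ} χ∈ = find (∈-concatMap⁻ ±subformulas {xs = subformulas φ} χ∈)

∈-closure : φ ∈ closure φ
∈-closure = closure⁺ (here refl) (here refl)

closure-closed : ∀ φ → Closed (closure φ)
closure-closed φ = record { subformula-closed = subformula-closed ; ∼-closed = ∼-closed }
  where
  subformula-closed : χ ∈ closure φ → a ∈ subformulas χ → a ∈ closure φ
  subformula-closed χ∈ a∈ = let ψ , ψ∈ , χ∈ψ = closure⁻ χ∈ in closure⁺ ψ∈ (++-trans ψ (∼ ψ) a∈ χ∈ψ)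

  ∼-closed : ModalOver a χ → χ ∈ closure φ → ∼ a ∈ closure φ
  ∼-closed {a} {χ} o χ∈ =
    let ψ , ψ∈ , χ∈ψ = closure⁻ χ∈
    in closure⁺ (subformula-trans (argument∈ ψ χ∈ψ) ψ∈) (∈-++⁺ʳ (subformulas a) (here refl))
    where
    argument∈ : ∀ ψ → χ ∈ ±subformulas ψ → a ∈ subformulas ψ
    argument∈ ψ χ∈ψ with ∈-++⁻ (subformulas ψ) χ∈ψ
    ... | inj₁ χ∈ψ = subformula-trans (modalOver-subformula o) χ∈ψ
    ... | inj₂ χ∈∼ψ = modalOver-∼ ψ o χ∈∼ψ

atLeast-zero : ∀ M R w (P : W M → Set) → AtLeastM M R w P 0
atLeast-zero M R w P = (λ ()) , (λ { {()} }) , λ ()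

∼-sound : ∀ M w ψ → M , w ⊨ (∼ ψ) → ¬ (M , w ⊨ ψ)
∼-sound M w (atom p) w⊭p w⊨p = w⊭p w⊨p
∼-sound M w (natom p) w⊨p w⊭p = w⊭p w⊨p
∼-sound M w (a ∧f b) (inj₁ ∼a) (a⁺ , _) = ∼-sound M w a ∼a a⁺
∼-sound M w (a ∧f b) (inj₂ ∼b) (_ , b⁺) = ∼-sound M w b ∼b b⁺
∼-sound M w (a ∨f b) (∼a , _) (inj₁ a⁺) = ∼-sound M w a ∼a a⁺
∼-sound M w (a ∨f b) (_ , ∼b) (inj₂ b⁺) = ∼-sound M w b ∼b b⁺
∼-sound M w (⟨ _ ⟩≥ zero ∙ _) (p , ¬p) _ = ¬p p
∼-sound M w (⟨ _ ⟩≥ suc _ ∙ _) ≤n ≥n+1 = ≤n ≥n+1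
∼-sound M w (⟨ _ ⟩≤ _ ∙ _) ≥n+1 ≤n = ≤n ≥n+1

∼-complete : ∀ M w ψ → ¬ ¬ ((M , w ⊨ ψ) ⊎ (M , w ⊨ (∼ ψ)))
∼-complete M w (atom p) k = k (inj₂ λ w⊨p → k (inj₁ w⊨p))
∼-complete M w (natom p) k = k (inj₁ λ w⊨p → k (inj₂ w⊨p))
∼-complete M w (a ∧f b) k = ∼-complete M w a λ
  { (inj₂ ∼a) → k (inj₂ (inj₁ ∼a))
  ; (inj₁ a⁺) → ∼-complete M w b λ
      { (inj₂ ∼b) → k (inj₂ (inj₂ ∼b))
      ; (inj₁ b⁺) → k (inj₁ (a⁺ , b⁺)) } }
∼-complete M w (a ∨f b) k = ∼-complete M w a λ
  { (inj₁ a⁺) → k (inj₁ (inj₁ a⁺))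
  ; (inj₂ ∼a) → ∼-complete M w b λ
      { (inj₁ b⁺) → k (inj₁ (inj₂ b⁺))
      ; (inj₂ ∼b) → k (inj₂ (∼a , ∼b)) } }
∼-complete M w (⟨ R ⟩≥ zero ∙ a) k = k (inj₁ (atLeast-zero M R w (λ v → M , v ⊨ a)))
∼-complete M w (⟨ _ ⟩≥ suc _ ∙ _) k = k (inj₂ λ ≥n+1 → k (inj₁ ≥n+1))
∼-complete M w (⟨ _ ⟩≤ _ ∙ _) k = k (inj₁ λ ≥n+1 → k (inj₂ ≥n+1))

-- Constraint systems

infix 4 _≟ᶜ_

_≟ᶜ_ : DecidableEquality Constraint
(x ⊨c a) ≟ᶜ (y ⊨c b) = map′ (λ { (refl , refl) → refl }) (λ { refl → refl , refl }) (x ≟ y ×-dec a ≟ᶠ b)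
rel R x y ≟ᶜ rel R′ x′ y′ =
  map′ (λ { (refl , refl , refl) → refl }) (λ { refl → refl , refl , refl }) (R ≟ R′ ×-dec x ≟ x′ ×-dec y ≟ y′)
(_ ⊨c _) ≟ᶜ rel _ _ _ = no λ ()
rel _ _ _ ≟ᶜ (_ ⊨c _) = no λ ()

open import Data.List.Membership.DecPropositional _≟ᶜ_ using (_∈?_)

maxVarᶜ : Constraint → Var
maxVarᶜ (x ⊨c _) = x
maxVarᶜ (rel _ x y) = x ⊔ y

maxVar : CS → Var
maxVar [] = 0
maxVar (c ∷ S) = maxVarᶜ c ⊔ maxVar S

occurs⇒≤maxVar : Occurs y S → y ≤ maxVar S
occurs⇒≤maxVar {S = c ∷ S} (here y∈c) = ≤-trans (occursᶜ⇒≤ c y∈c) (m≤m⊔n _ _)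
  where
  occursᶜ⇒≤ : ∀ c → OccursC y c → y ≤ maxVarᶜ c
  occursᶜ⇒≤ (_ ⊨c _) refl = ≤-refl
  occursᶜ⇒≤ (rel _ x z) (inj₁ refl) = m≤m⊔n x z
  occursᶜ⇒≤ (rel _ x z) (inj₂ refl) = m≤n⊔m x z
occurs⇒≤maxVar {S = c ∷ S} (there y∈S) = ≤-trans (occurs⇒≤maxVar y∈S) (m≤n⊔m _ _)

fresh : CS → Var
fresh S = suc (maxVar S)

fresh-∉ : ¬ Occurs (fresh S) S
fresh-∉ o = 1+n≰n (occurs⇒≤maxVar o)

occurs? : ∀ y S → Dec (Occurs y S)
occurs? y = any? occursᶜ?
  where
  occursᶜ? : ∀ c → Dec (OccursC y c)
  occursᶜ? (x ⊨c _) = y ≟ x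
  occursᶜ? (rel _ x z) = y ≟ x ⊎-dec y ≟ z

⊨-occurs : (x ⊨c ψ) ∈ S → Occurs x S
⊨-occurs m = lose m refl

source-occurs : rel R x y ∈ S → Occurs x S
source-occurs m = lose m (inj₁ refl)

target-occurs : rel R x y ∈ S → Occurs y S
target-occurs m = lose m (inj₂ refl)

occurs-⊆ : S ⊆ S′ → Occurs y S → Occurs y S′
occurs-⊆ S⊆S′ o = let _ , c∈S , y∈c = find o in lose (S⊆S′ c∈S) y∈c

occurs⇒≢ : ¬ Occurs y S → Occurs x S → x ≢ y
occurs⇒≢ y∉S x∈S refl = y∉S x∈S

IsSuccessor : CS → Rel → Var → Form → Var → Set
IsSuccessor S R x ψ y = (rel R x y ∈ S) × ((y ⊨c ψ) ∈ S)

isSuccessor? : ∀ S R x ψ y → Dec (IsSuccessor S R x ψ y)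
isSuccessor? S R x ψ y = rel R x y ∈? S ×-dec (y ⊨c ψ) ∈? S

successors : CS → Rel → Var → Form → List Var
successors S R x ψ = filter (isSuccessor? S R x ψ) (upTo (fresh S))

♯ : CS → Rel → Var → Form → ℕ
♯ S R x ψ = length (successors S R x ψ)

successors⁺ : IsSuccessor S R x ψ y → y ∈ successors S R x ψ
successors⁺ {S = S} {R} {x} {ψ} s@(r , _) = ∈-filter⁺ (isSuccessor? S R x ψ) (∈-upTo⁺ (s≤s (occurs⇒≤maxVar (target-occurs r)))) s

successors⁻ : y ∈ successors S R x ψ → IsSuccessor S R x ψ y
successors⁻ {S = S} {R} {x} {ψ} m = proj₂ (∈-filter⁻ (isSuccessor? S R x ψ) m)

successors-unique : ∀ S R x ψ → Unique (successors S R x ψ)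
successors-unique S R x ψ = filter⁺ (isSuccessor? S R x ψ) (upTo⁺ (fresh S))

atLeast⇒≤♯ : AtLeastS S R x ψ n → n ≤ ♯ S R x ψ
atLeast⇒≤♯ (f , f-inj , f-succ) = injective-cover⇒≤length (λ y → y) f f-inj (successors⁺ ∘ f-succ)

≤♯⇒atLeast : n ≤ ♯ S R x ψ → AtLeastS S R x ψ n
≤♯⇒atLeast {S = S} {R} {x} {ψ} n≤♯ =
  let f , f-inj , f∈ = unique⇒injective-members (successors-unique S R x ψ) n≤♯
  in f , f-inj , successors⁻ ∘ f∈

atLeast? : ∀ S R x ψ n → Dec (AtLeastS S R x ψ n)
atLeast? S R x ψ n = map′ ≤♯⇒atLeast atLeast⇒≤♯ (n ≤? ♯ S R x ψ)

atLeast-⊆ : S ⊆ S′ → AtLeastS S R x ψ n → AtLeastS S′ R x ψ n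
atLeast-⊆ S⊆S′ (f , f-inj , f-succ) = f , f-inj , λ i → S⊆S′ (proj₁ (f-succ i)) , S⊆S′ (proj₂ (f-succ i))

♯-mono : S ⊆ S′ → ♯ S R x ψ ≤ ♯ S′ R x ψ
♯-mono S⊆S′ = atLeast⇒≤♯ (atLeast-⊆ S⊆S′ (≤♯⇒atLeast ≤-refl))

♯-grows : ¬ Occurs y S → S ⊆ S′ → IsSuccessor S′ R x ψ y → suc (♯ S R x ψ) ≤ ♯ S′ R x ψ
♯-grows {y} {S} {S′} {R} {x} {ψ} y-fresh S⊆S′ y-succ =
  unique-⊆⇒length≤ (All.tabulate y≢old ∷ successors-unique S R x ψ) succ⊆
  where
  y≢old : ∀ {u} → u ∈ successors S R x ψ → y ≢ u
  y≢old u∈ y≡u = occurs⇒≢ y-fresh (target-occurs (proj₁ (successors⁻ u∈))) (sym y≡u)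

  succ⊆ : y ∷ successors S R x ψ ⊆ successors S′ R x ψ
  succ⊆ (here refl) = successors⁺ y-succ
  succ⊆ (there u∈) = let r , u⊨ψ = successors⁻ u∈ in successors⁺ (S⊆S′ r , S⊆S′ u⊨ψ)

formulasAt : Var → CS → List Form
formulasAt z [] = []
formulasAt z ((x ⊨c ψ) ∷ S) with z ≟ x
... | yes _ = ψ ∷ formulasAt z S
... | no _ = formulasAt z S
formulasAt z (rel _ _ _ ∷ S) = formulasAt z S

formulasAt⁺ : (x ⊨c ψ) ∈ S → ψ ∈ formulasAt x S
formulasAt⁺ {x = x} {S = (v ⊨c _) ∷ _} x⊨ψ with x ≟ v | x⊨ψ
... | yes _ | here refl = here refl
... | yes _ | there m = there (formulasAt⁺ m)
... | no x≢x | here refl = ⊥-elim (x≢x refl)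
... | no _ | there m = formulasAt⁺ m
formulasAt⁺ {S = rel _ _ _ ∷ _} (there m) = formulasAt⁺ m

formulasAt⁻ : ψ ∈ formulasAt x S → (x ⊨c ψ) ∈ S
formulasAt⁻ {x = x} {S = (v ⊨c _) ∷ _} m with x ≟ v | m
... | yes refl | here refl = here refl
... | yes _ | there m′ = there (formulasAt⁻ m′)
... | no _ | m′ = there (formulasAt⁻ m′)
formulasAt⁻ {S = rel _ _ _ ∷ _} m = there (formulasAt⁻ m)

argumentIf : Rel → Rel → Form → List Form
argumentIf R R′ ψ with R′ ≟ R
... | yes _ = ψ ∷ []
... | no _ = []

argumentIf-refl : ∀ R ψ → ψ ∈ argumentIf R R ψ
argumentIf-refl R ψ with R ≟ R
... | yes _ = here refl
... | no R≢R = ⊥-elim (R≢R refl)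

argumentIf⁻ : ∀ {R R′ ψ ψ′} → ψ′ ∈ argumentIf R R′ ψ → R′ ≡ R × ψ′ ≡ ψ
argumentIf⁻ {R} {R′} ψ′∈ with R′ ≟ R | ψ′∈
... | yes R′≡R | here ψ′≡ψ = R′≡R , ψ′≡ψ

modalArgs : Rel → Form → List Form
modalArgs R (⟨ R′ ⟩≥ _ ∙ ψ) = argumentIf R R′ ψ
modalArgs R (⟨ R′ ⟩≤ _ ∙ ψ) = argumentIf R R′ ψ
modalArgs R _ = []

modalSet : CS → Rel → Var → List Form
modalSet S R x = concatMap (modalArgs R) (formulasAt x S)

modalSet⁺ : InModalSet S R x ψ → ψ ∈ modalSet S R x
modalSet⁺ {R = R} {ψ = ψ} (_ , inj₁ x⊨χ) = ∈-concatMap⁺ (modalArgs R) (lose (formulasAt⁺ x⊨χ) (argumentIf-refl R ψ))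
modalSet⁺ {R = R} {ψ = ψ} (_ , inj₂ x⊨χ) = ∈-concatMap⁺ (modalArgs R) (lose (formulasAt⁺ x⊨χ) (argumentIf-refl R ψ))

modalSet⁻ : ψ ∈ modalSet S R x → InModalSet S R x ψ
modalSet⁻ {ψ = ψ} {S = S} {R = R} {x = x} m =
  let χ , χ∈ , ψ∈ = find (∈-concatMap⁻ (modalArgs R) m) in args⁻ χ (formulasAt⁻ χ∈) ψ∈
  where
  args⁻ : ∀ χ → (x ⊨c χ) ∈ S → ψ ∈ modalArgs R χ → InModalSet S R x ψ
  args⁻ (⟨ _ ⟩≥ m ∙ _) x⊨χ ψ∈ with argumentIf⁻ ψ∈
  ... | refl , refl = m , inj₁ x⊨χ
  args⁻ (⟨ _ ⟩≤ m ∙ _) x⊨χ ψ∈ with argumentIf⁻ ψ∈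
  ... | refl , refl = m , inj₂ x⊨χ

depth : CS → Var → ℕ
depth S z = max 0 (map md (formulasAt z S))

md≤depth : (x ⊨c ψ) ∈ S → md ψ ≤ depth S x
md≤depth x⊨ψ = v≤max⁺ 0 _ (inj₂ (Any.map ≤-reflexive (∈-map⁺ md (formulasAt⁺ x⊨ψ))))

depth≤ : ∀ {d} → (∀ {ψ} → (x ⊨c ψ) ∈ S → md ψ ≤ d) → depth S x ≤ d
depth≤ bound = max≤v⁺ z≤n (AllP.map⁺ (All.tabulate (bound ∘ formulasAt⁻)))

depth< : ∀ {d} → 0 < d → (∀ {ψ} → (x ⊨c ψ) ∈ S → md ψ < d) → depth S x < d
depth< 0<d bound = max<v⁺ 0<d (AllP.map⁺ (All.tabulate (bound ∘ formulasAt⁻)))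

depth-≡ : S ⊆ S′ → (∀ {ψ} → (x ⊨c ψ) ∈ S′ → md ψ ≤ depth S x) → depth S′ x ≡ depth S x
depth-≡ S⊆S′ bound = ≤-antisym (depth≤ bound) (depth≤ (md≤depth ∘ S⊆S′))

step-⊆ : Step S S′ → S ⊆ S′
step-⊆ (∧-rule _ _ _ _ _) = there ∘ there
step-⊆ (∨-rule _ _ _ _ _ _ _ _) = there
step-⊆ (≥-rule _ _ _ _ _ _ L _ _ _ _ _ _ _) = there ∘ there ∘ ∈-++⁺ʳ L

AgreeAt : Var → CS → CS → Set
AgreeAt x S S′ = ∀ {ψ} → (x ⊨c ψ) ∈ S′ → (x ⊨c ψ) ∈ S

Saturated : CS → Var → Set
Saturated S x = ¬ ∧Applies S x × ¬ ∨Applies S x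

saturated-⊆ : S ⊆ S′ → AgreeAt x S S′ → Saturated S x → Saturated S′ x
saturated-⊆ S⊆S′ agree (¬∧ , ¬∨) =
  (λ (a , b , m , ¬both) → ¬∧ (a , b , agree m , λ (a∈ , b∈) → ¬both (S⊆S′ a∈ , S⊆S′ b∈))) ,
  (λ (a , b , m , a∉ , b∉) → ¬∨ (a , b , agree m , a∉ ∘ S⊆S′ , b∉ ∘ S⊆S′))

inModalSet-back : AgreeAt x S S′ → InModalSet S′ R x ψ → InModalSet S R x ψ
inModalSet-back agree (m , inj₁ x⊨χ) = m , inj₁ (agree x⊨χ)
inModalSet-back agree (m , inj₂ x⊨χ) = m , inj₂ (agree x⊨χ)

module Expansion (x : Var) (χs : List Form) (S : CS) where

  expanded : CS
  expanded = map (x ⊨c_) χs ++ S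

  ⊨∈⁻ : ∀ {v χ} → (v ⊨c χ) ∈ expanded → (v ≡ x × χ ∈ χs) ⊎ (v ⊨c χ) ∈ S
  ⊨∈⁻ m with ∈-++⁻ (map (x ⊨c_) χs) m
  ... | inj₂ m∈S = inj₂ m∈S
  ... | inj₁ m∈new with ∈-map⁻ (x ⊨c_) m∈new
  ...   | _ , χ∈ , refl = inj₁ (refl , χ∈)

  rel∈⁻ : ∀ {R u v} → rel R u v ∈ expanded → rel R u v ∈ S
  rel∈⁻ m with ∈-++⁻ (map (x ⊨c_) χs) m
  ... | inj₂ m∈S = m∈S
  ... | inj₁ m∈new with ∈-map⁻ (x ⊨c_) m∈new
  ...   | _ , _ , ()

  occurs⁻ : ∀ {z} → Occurs x S → Occurs z expanded → Occurs z S
  occurs⁻ x∈S o with find o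
  ... | c , c∈ , z∈c with ∈-++⁻ (map (x ⊨c_) χs) c∈
  ...   | inj₂ c∈S = lose c∈S z∈c
  ...   | inj₁ c∈new with ∈-map⁻ (x ⊨c_) c∈new
  ...     | _ , _ , refl with z∈c
  ...       | refl = x∈S

  agree : ∀ {v} → v ≢ x → AgreeAt v S expanded
  agree v≢x m with ⊨∈⁻ m
  ... | inj₁ (v≡x , _) = ⊥-elim (v≢x v≡x)
  ... | inj₂ m∈S = m∈S

Chosen : CS → Rel → Var → Var → (Form → Bool) → CS → Set
Chosen S R x y ch L = ∀ c → c ∈ L → Σ[ ψ′ ∈ Form ] (InModalSet S R x ψ′ × (c ≡ (y ⊨c select ch ψ′)))

data Offspring (S : CS) (R : Rel) (x : Var) (ψ : Form) (ch : Form → Bool) : Form → Set where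
  target : Offspring S R x ψ ch ψ
  chosen : ∀ {ψ′} → InModalSet S R x ψ′ → Offspring S R x ψ ch (select ch ψ′)

module Generation {S : CS} {x : Var} {R : Rel} {ψ : Form} {y : Var} {ch : Form → Bool} {L : CS}
  (L-shape : Chosen S R x y ch L) where

  generated : CS
  generated = rel R x y ∷ (y ⊨c ψ) ∷ L ++ S

  ⊨∈⁻ : ∀ {v χ} → (v ⊨c χ) ∈ generated → (v ≡ y × Offspring S R x ψ ch χ) ⊎ (v ⊨c χ) ∈ S
  ⊨∈⁻ (there (here refl)) = inj₁ (refl , target)
  ⊨∈⁻ (there (there m)) with ∈-++⁻ L m
  ... | inj₂ m∈S = inj₂ m∈S
  ... | inj₁ m∈L with L-shape _ m∈L
  ...   | _ , im , refl = inj₁ (refl , chosen im)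

  rel∈⁻ : ∀ {R′ u v} → rel R′ u v ∈ generated → (R′ ≡ R × u ≡ x × v ≡ y) ⊎ rel R′ u v ∈ S
  rel∈⁻ (here refl) = inj₁ (refl , refl , refl)
  rel∈⁻ (there (there m)) with ∈-++⁻ L m
  ... | inj₂ m∈S = inj₂ m∈S
  ... | inj₁ m∈L with L-shape _ m∈L
  ...   | _ , _ , ()

  occurs⁻ : ∀ {z} → Occurs x S → Occurs z generated → z ≡ y ⊎ Occurs z S
  occurs⁻ x∈S (here (inj₁ refl)) = inj₂ x∈S
  occurs⁻ x∈S (here (inj₂ refl)) = inj₁ refl
  occurs⁻ x∈S (there (here refl)) = inj₁ refl
  occurs⁻ x∈S (there (there o)) with find o
  ... | c , c∈ , z∈c with ∈-++⁻ L c∈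
  ...   | inj₂ c∈S = inj₂ (lose c∈S z∈c)
  ...   | inj₁ c∈L with L-shape c c∈L
  ...     | _ , _ , refl = inj₁ z∈c

  agree : ∀ {v} → v ≢ y → AgreeAt v S generated
  agree v≢y m with ⊨∈⁻ m
  ... | inj₁ (v≡y , _) = ⊥-elim (v≢y v≡y)
  ... | inj₂ m∈S = m∈S

chosenConstraints : CS → Var → Rel → (Form → Bool) → CS
chosenConstraints S x R ch = map (λ ψ′ → fresh S ⊨c select ch ψ′) (modalSet S R x)

chosen-shape : ∀ {S x R ch} → Chosen S R x (fresh S) ch (chosenConstraints S x R ch)
chosen-shape c m = let ψ′ , ψ′∈ , c≡ = ∈-map⁻ _ m in ψ′ , modalSet⁻ ψ′∈ , c≡

chosen-complete : ∀ {S x R ch} ψ′ → InModalSet S R x ψ′ → (fresh S ⊨c select ch ψ′) ∈ chosenConstraints S x R ch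
chosen-complete ψ′ im = ∈-map⁺ _ (modalSet⁺ im)

choices : CS → Var → Rel → List (Form → Bool)
choices S x R = boolFunctions _≟ᶠ_ (modalSet S R x)

≥-child : CS → Var → Rel → Form → (Form → Bool) → CS
≥-child S x R ψ ch = rel R x (fresh S) ∷ (fresh S ⊨c ψ) ∷ chosenConstraints S x R ch ++ S

≥-step : ∀ {S x R n ψ} ch → (x ⊨c (⟨ R ⟩≥ n ∙ ψ)) ∈ S → ¬ AtLeastS S R x ψ n → Saturated S x →
  Step S (≥-child S x R ψ ch)
≥-step ch x⊨≥ ¬atLeast (¬∧ , ¬∨) =
  ≥-rule _ _ _ _ _ ch _ x⊨≥ ¬atLeast ¬∧ ¬∨ fresh-∉ chosen-shape chosen-complete

run-⊆ : Step* S S′ → S ⊆ S′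
run-⊆ ε = λ m → m
run-⊆ (step ◅ run) = run-⊆ run ∘ step-⊆ step

-- Soundness

SuccessorsDecide : CS → Set
SuccessorsDecide S = ∀ {R x y ψ} → rel R x y ∈ S → InModalSet S R x ψ → ((y ⊨c ψ) ∈ S) ⊎ ((y ⊨c (∼ ψ)) ∈ S)

module Canonical (S : CS) (complete : Complete S) (clash-free : ClashFree S)
  (successors-decide : SuccessorsDecide S)
  where

  model : Model
  model = record { W = Var ; acc = λ R x y → rel R x y ∈ S ; val = λ p x → (x ⊨c atom p) ∈ S }

  ∧-saturated : (x ⊨c (a ∧f b)) ∈ S → ((x ⊨c a) ∈ S) × ((x ⊨c b) ∈ S)
  ∧-saturated {x} {a} {b} m with (x ⊨c a) ∈? S | (x ⊨c b) ∈? S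
  ... | yes a∈ | yes b∈ = a∈ , b∈
  ... | no a∉ | _ = ⊥-elim (complete _ (∧-rule x a b m (a∉ ∘ proj₁)))
  ... | yes _ | no b∉ = ⊥-elim (complete _ (∧-rule x a b m (b∉ ∘ proj₂)))

  ∨-saturated : (x ⊨c (a ∨f b)) ∈ S → ((x ⊨c a) ∈ S) ⊎ ((x ⊨c b) ∈ S)
  ∨-saturated {x} {a} {b} m with (x ⊨c a) ∈? S | (x ⊨c b) ∈? S
  ... | yes a∈ | _ = inj₁ a∈
  ... | no _ | yes b∈ = inj₂ b∈
  ... | no a∉ | no b∉ = ⊥-elim (complete _ (∨-rule x a b a m a∉ b∉ (inj₁ refl)))

  saturated : Saturated S x
  saturated {x} = (λ (a , b , m , ¬both) → complete _ (∧-rule x a b m ¬both)) ,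
                  (λ (a , b , m , a∉ , b∉) → complete _ (∨-rule x a b a m a∉ b∉ (inj₁ refl)))

  ≥-true : ∀ {n} → (∀ {y} → (y ⊨c ψ) ∈ S → model , y ⊨ ψ) → (x ⊨c (⟨ R ⟩≥ n ∙ ψ)) ∈ S → model , x ⊨ (⟨ R ⟩≥ n ∙ ψ)
  ≥-true {ψ} {x} {R} {n} ψ-true m with atLeast? S R x ψ n
  ... | yes (f , f-inj , f-succ) = f , f-inj , λ i → proj₁ (f-succ i) , ψ-true (proj₂ (f-succ i))
  ... | no ¬atLeast = ⊥-elim (complete _ (≥-step (λ _ → true) m ¬atLeast saturated))

  -- every successor carries ψ or ∼ ψ, so those satisfying ψ carry ψ, and there are at most n of them
  ≤-true : ∀ {n} → (∀ {y} → (y ⊨c (∼ ψ)) ∈ S → model , y ⊨ (∼ ψ)) → (x ⊨c (⟨ R ⟩≤ n ∙ ψ)) ∈ S →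
    model , x ⊨ (⟨ R ⟩≤ n ∙ ψ)
  ≤-true {ψ} {x} {R} {n} ∼ψ-true m (f , f-inj , f-succ) =
    clash-free (inj₂ (x , R , n , ψ , m , f , f-inj , λ i → proj₁ (f-succ i) , carries i))
    where
    carries : ∀ i → (f i ⊨c ψ) ∈ S
    carries i with successors-decide (proj₁ (f-succ i)) (n , inj₂ m)
    ... | inj₁ ψ∈ = ψ∈
    ... | inj₂ ∼ψ∈ = ⊥-elim (∼-sound model (f i) ψ (∼ψ-true ∼ψ∈) (proj₂ (f-succ i)))

  truth : ∀ ψ → (∀ {x} → (x ⊨c ψ) ∈ S → model , x ⊨ ψ) × (∀ {x} → (x ⊨c (∼ ψ)) ∈ S → model , x ⊨ (∼ ψ))
  truth (atom p) = (λ m → m) , λ {x} x⊨¬p x⊨p → clash-free (inj₁ (x , p , x⊨p , x⊨¬p))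
  truth (natom p) = (λ {x} x⊨¬p x⊨p → clash-free (inj₁ (x , p , x⊨p , x⊨¬p))) , λ m → m
  truth (a ∧f b) =
    (λ m → proj₁ (truth a) (proj₁ (∧-saturated m)) , proj₁ (truth b) (proj₂ (∧-saturated m))) ,
    (Sum.map (proj₂ (truth a)) (proj₂ (truth b)) ∘ ∨-saturated)
  truth (a ∨f b) =
    (Sum.map (proj₁ (truth a)) (proj₁ (truth b)) ∘ ∨-saturated) ,
    (λ m → proj₂ (truth a) (proj₁ (∧-saturated m)) , proj₂ (truth b) (proj₂ (∧-saturated m)))
  truth (⟨ R ⟩≥ zero ∙ a) =
    ≥-true (proj₁ (truth a)) , λ {x} m → ⊥-elim (clash-free (inj₁ (x , 0 , ∧-saturated m)))
  truth (⟨ R ⟩≥ suc n ∙ a) = ≥-true (proj₁ (truth a)) , ≤-true (proj₂ (truth a))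
  truth (⟨ R ⟩≤ n ∙ a) = ≤-true (proj₂ (truth a)) , ≥-true (proj₁ (truth a))

-- Completeness

record Embedding (M : Model) (π : Var → W M) (S : CS) : Set where
  field
    sat : ∀ {x ψ} → (x ⊨c ψ) ∈ S → M , π x ⊨ ψ
    edges : ∀ {R x y} → rel R x y ∈ S → acc M R (π x) (π y)
    separates : ∀ {R x y z} → rel R x y ∈ S → rel R x z ∈ S → π y ≡ π z → y ≡ z

open Embedding

Unembeddable : CS → Set₁
Unembeddable S = ∀ M π → ¬ Embedding M π S

embedding-atLeast : ∀ {M π n} → Embedding M π S → AtLeastS S R x ψ n → AtLeastM M R (π x) (λ w → M , w ⊨ ψ) n
embedding-atLeast {π = π} emb (f , f-inj , f-succ) =
  π ∘ f ,
  (λ πfi≡πfj → f-inj (separates emb (proj₁ (f-succ _)) (proj₁ (f-succ _)) πfi≡πfj)) ,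
  λ i → edges emb (proj₁ (f-succ i)) , sat emb (proj₂ (f-succ i))

embedding-cong : ∀ {M π π′} → (∀ {v} → Occurs v S → π v ≡ π′ v) → Embedding M π S → Embedding M π′ S
embedding-cong {S} {M} π≗π′ emb = record
  { sat = λ {_} {ψ} m → subst (λ w → M , w ⊨ ψ) (π≗π′ (⊨-occurs m)) (sat emb m)
  ; edges = λ r → subst₂ (acc M _) (π≗π′ (source-occurs r)) (π≗π′ (target-occurs r)) (edges emb r)
  ; separates = λ r r′ e → separates emb r r′ (trans (π≗π′ (target-occurs r)) (trans e (sym (π≗π′ (target-occurs r′)))))
  }

embedding-expansion : ∀ {M π x χs} → Embedding M π S → (∀ {χ} → χ ∈ χs → M , π x ⊨ χ) →
  Embedding M π (Expansion.expanded x χs S)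
embedding-expansion {S} {M} {π} {x} {χs} emb new-true = record
  { sat = sat′
  ; edges = edges emb ∘ rel∈⁻
  ; separates = λ r r′ → separates emb (rel∈⁻ r) (rel∈⁻ r′)
  }
  where
  open Expansion x χs S

  sat′ : ∀ {v χ} → (v ⊨c χ) ∈ expanded → M , π v ⊨ χ
  sat′ m with ⊨∈⁻ m
  ... | inj₁ (refl , χ∈χs) = new-true χ∈χs
  ... | inj₂ m∈S = sat emb m∈S

_[_↦_] : (Var → A) → Var → A → Var → A
(π [ y ↦ w ]) v with v ≟ y
... | yes _ = w
... | no _ = π v

↦-same : ∀ (π : Var → A) y w → (π [ y ↦ w ]) y ≡ w
↦-same π y w with y ≟ y
... | yes _ = refl
... | no y≢y = ⊥-elim (y≢y refl)

↦-other : ∀ (π : Var → A) {y v} w → v ≢ y → (π [ y ↦ w ]) v ≡ π v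
↦-other π {y} {v} w v≢y with v ≟ y
... | yes v≡y = ⊥-elim (v≢y v≡y)
... | no _ = refl

embedding-generation : ∀ {M π x R ψ y ch L}
  (L-shape : Chosen S R x y ch L) →
  Embedding M π S → Occurs x S → ¬ Occurs y S →
  (w : W M) → acc M R (π x) w → (∀ {χ} → Offspring S R x ψ ch χ → M , w ⊨ χ) →
  (∀ {z} → rel R x z ∈ S → π z ≢ w) →
  Embedding M (π [ y ↦ w ]) (Generation.generated L-shape)
embedding-generation {S} {M} {π} {x} {R} {ψ} {y} L-shape emb x∈S y-fresh w x→w offspring-true distinct = record
  { sat = sat′
  ; edges = edges′
  ; separates = separates′
  }
  where
  open Generation L-shape

  π′ : Var → W M
  π′ = π [ y ↦ w ]

  old : ∀ {v} → Occurs v S → π′ v ≡ π v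
  old o = ↦-other π w (occurs⇒≢ y-fresh o)

  emb′ : Embedding M π′ S
  emb′ = embedding-cong (sym ∘ old) emb

  sat′ : ∀ {v χ} → (v ⊨c χ) ∈ generated → M , π′ v ⊨ χ
  sat′ {χ = χ} m with ⊨∈⁻ m
  ... | inj₁ (refl , off) = subst (λ u → M , u ⊨ χ) (sym (↦-same π y w)) (offspring-true off)
  ... | inj₂ m∈S = sat emb′ m∈S

  edges′ : ∀ {R′ u v} → rel R′ u v ∈ generated → acc M R′ (π′ u) (π′ v)
  edges′ r with rel∈⁻ r
  ... | inj₁ (refl , refl , refl) = subst₂ (acc M R) (sym (old x∈S)) (sym (↦-same π y w)) x→w
  ... | inj₂ r∈S = edges emb′ r∈S

  new≢old : ∀ {z} → rel R x z ∈ S → π′ y ≢ π′ z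
  new≢old r e = distinct r (trans (sym (old (target-occurs r))) (trans (sym e) (↦-same π y w)))

  separates′ : ∀ {R′ u v v′} → rel R′ u v ∈ generated → rel R′ u v′ ∈ generated → π′ v ≡ π′ v′ → v ≡ v′
  separates′ r r′ e with rel∈⁻ r | rel∈⁻ r′
  ... | inj₁ (_ , _ , refl) | inj₁ (_ , _ , refl) = refl
  ... | inj₁ (refl , refl , refl) | inj₂ r′∈S = ⊥-elim (new≢old r′∈S e)
  ... | inj₂ r∈S | inj₁ (refl , refl , refl) = ⊥-elim (new≢old r∈S (sym e))
  ... | inj₂ r∈S | inj₂ r′∈S = separates emb′ r∈S r′∈S e

initial-embedding : ∀ {M w} → M , w ⊨ φ → Embedding M (λ _ → w) (initial φ)
initial-embedding w⊨φ = record
  { sat = λ { (here refl) → w⊨φ }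
  ; edges = λ { (here ()) }
  ; separates = λ { (here ()) }
  }

data PropRedex (S : CS) : Constraint → Set where
  ∧-redex : ∀ {x a b} → ¬ (((x ⊨c a) ∈ S) × ((x ⊨c b) ∈ S)) → PropRedex S (x ⊨c (a ∧f b))
  ∨-redex : ∀ {x a b} → (x ⊨c a) ∉ S → (x ⊨c b) ∉ S → PropRedex S (x ⊨c (a ∨f b))

data ≥-Redex (S : CS) : Constraint → Set where
  ≥-redex : ∀ {x R n ψ} → ¬ AtLeastS S R x ψ n → ≥-Redex S (x ⊨c (⟨ R ⟩≥ n ∙ ψ))

data Clashing (S : CS) : Constraint → Set where
  atom-clash : ∀ {x p} → (x ⊨c natom p) ∈ S → Clashing S (x ⊨c atom p)
  ≤-clash : ∀ {x R n ψ} → AtLeastS S R x ψ (suc n) → Clashing S (x ⊨c (⟨ R ⟩≤ n ∙ ψ))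

propRedex? : ∀ S c → Dec (PropRedex S c)
propRedex? S (x ⊨c (a ∧f b)) = map′ ∧-redex (λ { (∧-redex ¬both) → ¬both }) (¬? ((x ⊨c a) ∈? S ×-dec (x ⊨c b) ∈? S))
propRedex? S (x ⊨c (a ∨f b)) =
  map′ (λ (a∉ , b∉) → ∨-redex a∉ b∉) (λ { (∨-redex a∉ b∉) → a∉ , b∉ }) (¬? ((x ⊨c a) ∈? S) ×-dec ¬? ((x ⊨c b) ∈? S))
propRedex? S (_ ⊨c atom _) = no λ ()
propRedex? S (_ ⊨c natom _) = no λ ()
propRedex? S (_ ⊨c (⟨ _ ⟩≥ _ ∙ _)) = no λ ()
propRedex? S (_ ⊨c (⟨ _ ⟩≤ _ ∙ _)) = no λ ()
propRedex? S (rel _ _ _) = no λ ()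

≥-redex? : ∀ S c → Dec (≥-Redex S c)
≥-redex? S (x ⊨c (⟨ R ⟩≥ n ∙ ψ)) = map′ ≥-redex (λ { (≥-redex ¬atLeast) → ¬atLeast }) (¬? (atLeast? S R x ψ n))
≥-redex? S (_ ⊨c atom _) = no λ ()
≥-redex? S (_ ⊨c natom _) = no λ ()
≥-redex? S (_ ⊨c (_ ∧f _)) = no λ ()
≥-redex? S (_ ⊨c (_ ∨f _)) = no λ ()
≥-redex? S (_ ⊨c (⟨ _ ⟩≤ _ ∙ _)) = no λ ()
≥-redex? S (rel _ _ _) = no λ ()

clashing? : ∀ S c → Dec (Clashing S c)
clashing? S (x ⊨c atom p) = map′ atom-clash (λ { (atom-clash x⊨¬p) → x⊨¬p }) ((x ⊨c natom p) ∈? S)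
clashing? S (x ⊨c (⟨ R ⟩≤ n ∙ ψ)) = map′ ≤-clash (λ { (≤-clash atLeast) → atLeast }) (atLeast? S R x ψ (suc n))
clashing? S (_ ⊨c natom _) = no λ ()
clashing? S (_ ⊨c (_ ∧f _)) = no λ ()
clashing? S (_ ⊨c (_ ∨f _)) = no λ ()
clashing? S (_ ⊨c (⟨ _ ⟩≥ _ ∙ _)) = no λ ()
clashing? S (rel _ _ _) = no λ ()

no-redex⇒saturated : ¬ Any (PropRedex S) S → Saturated S x
no-redex⇒saturated ¬redex =
  (λ (_ , _ , m , ¬both) → ¬redex (lose m (∧-redex ¬both))) ,
  (λ (_ , _ , m , a∉ , b∉) → ¬redex (lose m (∨-redex a∉ b∉)))

no-redex⇒complete : ¬ Any (PropRedex S) S → ¬ Any (≥-Redex S) S → Complete S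
no-redex⇒complete ¬prop ¬≥ _ (∧-rule _ _ _ m ¬both) = ¬prop (lose m (∧-redex ¬both))
no-redex⇒complete ¬prop ¬≥ _ (∨-rule _ _ _ _ m a∉ b∉ _) = ¬prop (lose m (∨-redex a∉ b∉))
no-redex⇒complete ¬prop ¬≥ _ (≥-rule _ _ _ _ _ _ _ m ¬atLeast _ _ _ _ _) = ¬≥ (lose m (≥-redex ¬atLeast))

no-clashing⇒clash-free : ¬ Any (Clashing S) S → ClashFree S
no-clashing⇒clash-free ¬clashing (inj₁ (_ , _ , m , x⊨¬p)) = ¬clashing (lose m (atom-clash x⊨¬p))
no-clashing⇒clash-free ¬clashing (inj₂ (_ , _ , _ , _ , m , atLeast)) = ¬clashing (lose m (≤-clash atLeast))

clashing⇒unembeddable : Any (Clashing S) S → Unembeddable S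
clashing⇒unembeddable {S} clashing M π emb = let _ , c∈S , clash = find clashing in refute c∈S clash
  where
  refute : ∀ {c} → c ∈ S → Clashing S c → ⊥
  refute m (atom-clash x⊨¬p) = sat emb x⊨¬p (sat emb m)
  refute m (≤-clash atLeast) = sat emb m (embedding-atLeast emb atLeast)

Success : CS → Set
Success S = Σ[ S′ ∈ CS ] (Step* S S′ × Complete S′ × ClashFree S′)

Outcome : CS → Set₁
Outcome S = Success S ⊎ Unembeddable S

success-◅ : Step S S′ → Success S′ → Success S
success-◅ step (S″ , run , complete , clash-free) = S″ , step ◅ run , complete , clash-free

step-outcome : Step S S′ → (Unembeddable S′ → Unembeddable S) → Outcome S′ → Outcome S
step-outcome step _ (inj₁ success) = inj₁ (success-◅ step success)
step-outcome _ back (inj₂ unembeddable) = inj₂ (back unembeddable)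

branch-outcome : ∀ {S₁ S₂} → Step S S₁ → Step S S₂ → (Unembeddable S₁ → Unembeddable S₂ → Unembeddable S) →
  Outcome S₁ → Outcome S₂ → Outcome S
branch-outcome step₁ _ _ (inj₁ success) _ = inj₁ (success-◅ step₁ success)
branch-outcome _ step₂ _ (inj₂ _) (inj₁ success) = inj₁ (success-◅ step₂ success)
branch-outcome _ _ back (inj₂ fail₁) (inj₂ fail₂) = inj₂ (back fail₁ fail₂)

module Tableau (Cl : List Form) (closed : Closed Cl) where

  open Closed closed

  -- sources-saturated holds since the ≥-rule fires only at saturated variables; it guarantees that the
  -- modal set of a variable never grows once it has successors, which preserves successors-decide
  record Invariant (S : CS) : Set where
    field
      formulas∈Cl : ∀ {x ψ} → (x ⊨c ψ) ∈ S → ψ ∈ Cl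
      successors-decide : SuccessorsDecide S
      sources-saturated : ∀ {R x y} → rel R x y ∈ S → Saturated S x

  open Invariant

  modal∈Cl : Invariant S → InModalSet S R x ψ → ψ ∈ Cl × ∼ ψ ∈ Cl
  modal∈Cl inv (_ , inj₁ m) = modal-closed ≥-over (formulas∈Cl inv m)
  modal∈Cl inv (_ , inj₂ m) = modal-closed ≤-over (formulas∈Cl inv m)

  invariant-expansion : ∀ {S x χs} → Invariant S → (∀ {R y} → rel R x y ∉ S) → (∀ {χ} → χ ∈ χs → χ ∈ Cl) →
    Invariant (Expansion.expanded x χs S)
  invariant-expansion {S} {x} {χs} inv leaf χs⊆Cl = record
    { formulas∈Cl = inCl
    ; successors-decide = λ r im → let r′ = rel∈⁻ r in
        Sum.map old⊆ old⊆ (successors-decide inv r′ (inModalSet-back (agree (source≢x r′)) im))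
    ; sources-saturated = λ r → let r′ = rel∈⁻ r in
        saturated-⊆ old⊆ (agree (source≢x r′)) (sources-saturated inv r′)
    }
    where
    open Expansion x χs S

    old⊆ : S ⊆ expanded
    old⊆ = ∈-++⁺ʳ (map (x ⊨c_) χs)

    source≢x : ∀ {R v w} → rel R v w ∈ S → v ≢ x
    source≢x r refl = leaf r

    inCl : ∀ {v χ} → (v ⊨c χ) ∈ expanded → χ ∈ Cl
    inCl m with ⊨∈⁻ m
    ... | inj₁ (_ , χ∈χs) = χs⊆Cl χ∈χs
    ... | inj₂ m∈S = formulas∈Cl inv m∈S

  invariant-generation : ∀ {S x R n ψ y ch L} → Invariant S → (x ⊨c (⟨ R ⟩≥ n ∙ ψ)) ∈ S →
    Saturated S x → ¬ Occurs y S →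
    (L-shape : Chosen S R x y ch L) →
    (∀ ψ′ → InModalSet S R x ψ′ → (y ⊨c select ch ψ′) ∈ L) →
    Invariant (Generation.generated L-shape)
  invariant-generation {S} {x} {R} {n} {ψ} {y} {ch} {L} inv x⊨≥ x-saturated y-fresh L-shape L-complete = record
    { formulas∈Cl = inCl
    ; successors-decide = decide
    ; sources-saturated = saturated
    }
    where
    open Generation L-shape

    old⊆ : S ⊆ generated
    old⊆ = there ∘ there ∘ ∈-++⁺ʳ L

    x≢y : x ≢ y
    x≢y = occurs⇒≢ y-fresh (⊨-occurs x⊨≥)

    old≢y : ∀ {R′ v w} → rel R′ v w ∈ S → v ≢ y
    old≢y r = occurs⇒≢ y-fresh (source-occurs r)

    inCl : ∀ {v χ} → (v ⊨c χ) ∈ generated → χ ∈ Cl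
    inCl m with ⊨∈⁻ m
    ... | inj₁ (_ , target) = proj₁ (modal-closed ≥-over (formulas∈Cl inv x⊨≥))
    ... | inj₁ (_ , chosen im) = select-elim (_∈ Cl) ch (proj₁ (modal∈Cl inv im)) (proj₂ (modal∈Cl inv im))
    ... | inj₂ m∈S = formulas∈Cl inv m∈S

    decide : ∀ {R′ v w ψ′} → rel R′ v w ∈ generated → InModalSet generated R′ v ψ′ →
      ((w ⊨c ψ′) ∈ generated) ⊎ ((w ⊨c (∼ ψ′)) ∈ generated)
    decide {ψ′ = ψ′} r im with rel∈⁻ r
    ... | inj₁ (refl , refl , refl) =
      select-elim (λ χ → (y ⊨c χ) ∈ generated → ((y ⊨c ψ′) ∈ generated) ⊎ ((y ⊨c (∼ ψ′)) ∈ generated)) ch inj₁ inj₂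
        (there (there (∈-++⁺ˡ (L-complete ψ′ (inModalSet-back (agree x≢y) im)))))
    ... | inj₂ r′ = Sum.map old⊆ old⊆ (successors-decide inv r′ (inModalSet-back (agree (old≢y r′)) im))

    saturated : ∀ {R′ v w} → rel R′ v w ∈ generated → Saturated generated v
    saturated r with rel∈⁻ r
    ... | inj₁ (refl , refl , refl) = saturated-⊆ old⊆ (agree x≢y) x-saturated
    ... | inj₂ r′ = saturated-⊆ old⊆ (agree (old≢y r′)) (sources-saturated inv r′)

  invariant-step : Invariant S → Step S S′ → Invariant S′
  invariant-step inv (∧-rule x a b x⊨∧ ¬both) =
    invariant-expansion inv (λ r → proj₁ (sources-saturated inv r) (a , b , x⊨∧ , ¬both)) conjuncts∈Cl
    where
    conjuncts∈Cl : ∀ {χ} → χ ∈ a ∷ b ∷ [] → χ ∈ Cl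
    conjuncts∈Cl (here refl) = proj₁ (∧-closed (formulas∈Cl inv x⊨∧))
    conjuncts∈Cl (there (here refl)) = proj₂ (∧-closed (formulas∈Cl inv x⊨∧))
  invariant-step inv (∨-rule x a b χ x⊨∨ a∉ b∉ χ≡) =
    invariant-expansion inv (λ r → proj₂ (sources-saturated inv r) (a , b , x⊨∨ , a∉ , b∉))
      λ { (here refl) → ≡-either (_∈ Cl) χ≡ (proj₁ (∨-closed (formulas∈Cl inv x⊨∨))) (proj₂ (∨-closed (formulas∈Cl inv x⊨∨))) }
  invariant-step inv (≥-rule x R n ψ y ch L x⊨≥ _ ¬∧ ¬∨ y-fresh L-shape L-complete) =
    invariant-generation inv x⊨≥ (¬∧ , ¬∨) y-fresh L-shape L-complete

  -- Termination

  missing : CS → Var → Form → ℕ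
  missing S z χ with (z ⊨c χ) ∈? S
  ... | yes _ = 0
  ... | no _ = 1

  unexpanded : CS → Var → ℕ
  unexpanded S z = sum (map (missing S z) Cl)

  demand : Form → ℕ
  demand (⟨ _ ⟩≥ n ∙ _) = n
  demand _ = 0

  deficit : CS → Var → Form → ℕ
  deficit S z (⟨ R ⟩≥ n ∙ ψ) = n ∸ ♯ S R z ψ
  deficit S z _ = 0

  totalDeficit : CS → Var → ℕ
  totalDeficit S z = sum (map (deficit S z) Cl)

  mutual
    -- weight (1 + d) exceeds the cost of any variable of depth d, so one unit of deficit at a
    -- variable of depth 1 + d pays for creating a successor of depth at most d
    weight : ℕ → ℕ
    weight zero = 0
    weight (suc d) = suc (costBound d)

    costBound : ℕ → ℕ
    costBound d = length Cl + weight d * sum (map demand Cl)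

  cost : CS → Var → ℕ
  cost S z = unexpanded S z + weight (depth S z) * totalDeficit S z

  missing-mono : ∀ {z} → S ⊆ S′ → ∀ χ → missing S′ z χ ≤ missing S z χ
  missing-mono {S} {S′} {z} S⊆S′ χ with (z ⊨c χ) ∈? S′ | (z ⊨c χ) ∈? S
  ... | yes _ | _ = z≤n
  ... | no ∉S′ | yes ∈S = ⊥-elim (∉S′ (S⊆S′ ∈S))
  ... | no _ | no _ = ≤-refl

  missing-< : ∀ {z χ} → (z ⊨c χ) ∉ S → (z ⊨c χ) ∈ S′ → missing S′ z χ < missing S z χ
  missing-< {S} {S′} {z} {χ} ∉S ∈S′ with (z ⊨c χ) ∈? S′ | (z ⊨c χ) ∈? S
  ... | yes _ | no _ = s≤s z≤n
  ... | yes _ | yes ∈S = ⊥-elim (∉S ∈S)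
  ... | no ∉S′ | _ = ⊥-elim (∉S′ ∈S′)

  missing≤1 : ∀ {z} χ → missing S z χ ≤ 1
  missing≤1 {S} {z} χ with (z ⊨c χ) ∈? S
  ... | yes _ = z≤n
  ... | no _ = ≤-refl

  deficit-mono : ∀ {z} → S ⊆ S′ → ∀ χ → deficit S′ z χ ≤ deficit S z χ
  deficit-mono S⊆S′ (⟨ _ ⟩≥ n ∙ _) = ∸-monoʳ-≤ n (♯-mono S⊆S′)
  deficit-mono S⊆S′ (atom _) = z≤n
  deficit-mono S⊆S′ (natom _) = z≤n
  deficit-mono S⊆S′ (_ ∧f _) = z≤n
  deficit-mono S⊆S′ (_ ∨f _) = z≤n
  deficit-mono S⊆S′ (⟨ _ ⟩≤ _ ∙ _) = z≤n

  deficit≤demand : ∀ {z} χ → deficit S z χ ≤ demand χ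
  deficit≤demand {S} {z} (⟨ R ⟩≥ n ∙ ψ) = m∸n≤m n (♯ S R z ψ)
  deficit≤demand (atom _) = z≤n
  deficit≤demand (natom _) = z≤n
  deficit≤demand (_ ∧f _) = z≤n
  deficit≤demand (_ ∨f _) = z≤n
  deficit≤demand (⟨ _ ⟩≤ _ ∙ _) = z≤n

  weight-mono : ∀ {d d′} → d ≤ d′ → weight d ≤ weight d′
  weight-mono {zero} _ = z≤n
  weight-mono {suc d} {suc d′} (s≤s d≤d′) = s≤s (+-monoʳ-≤ (length Cl) (*-monoˡ-≤ _ (weight-mono d≤d′)))

  costBound<weight : ∀ {d d′} → d < d′ → costBound d < weight d′
  costBound<weight = weight-mono

  cost≤costBound : ∀ S z → cost S z ≤ costBound (depth S z)
  cost≤costBound S z =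
    +-mono-≤ (sum-map-≤1 Cl missing≤1) (*-monoʳ-≤ (weight (depth S z)) (sum-map-mono Cl deficit≤demand))

  cost-mono : ∀ {z} → S ⊆ S′ → depth S′ z ≡ depth S z → cost S′ z ≤ cost S z
  cost-mono {S} {z = z} S⊆S′ depth≡ rewrite depth≡ =
    +-mono-≤ (sum-map-mono Cl (missing-mono S⊆S′)) (*-monoʳ-≤ (weight (depth S z)) (sum-map-mono Cl (deficit-mono S⊆S′)))

  cost-<-unexpanded : ∀ {z χ} → S ⊆ S′ → depth S′ z ≡ depth S z → χ ∈ Cl → (z ⊨c χ) ∉ S → (z ⊨c χ) ∈ S′ →
    cost S′ z < cost S z
  cost-<-unexpanded {S} {z = z} S⊆S′ depth≡ χ∈Cl ∉S ∈S′ rewrite depth≡ =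
    +-mono-<-≤ (sum-map-< Cl (missing-mono S⊆S′) χ∈Cl (missing-< ∉S ∈S′))
               (*-monoʳ-≤ (weight (depth S z)) (sum-map-mono Cl (deficit-mono S⊆S′)))

  cost-drop : ∀ {z χ} → S ⊆ S′ → depth S′ z ≡ depth S z → χ ∈ Cl → deficit S′ z χ < deficit S z χ →
    cost S′ z + weight (depth S z) ≤ cost S z
  cost-drop {S} {S′} {z} S⊆S′ depth≡ χ∈Cl deficit< rewrite depth≡ = begin
    u′ + ω * t′ + ω    ≡⟨ +-assoc u′ (ω * t′) ω ⟩
    u′ + (ω * t′ + ω)  ≡⟨ cong (u′ +_) (trans (+-comm (ω * t′) ω) (sym (*-suc ω t′))) ⟩
    u′ + ω * suc t′    ≤⟨ +-mono-≤ (sum-map-mono Cl (missing-mono S⊆S′))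
                                   (*-monoʳ-≤ ω (sum-map-< Cl (deficit-mono S⊆S′) χ∈Cl deficit<)) ⟩
    unexpanded S z + ω * totalDeficit S z ∎
    where
    open ≤-Reasoning
    u′ t′ ω : ℕ
    u′ = unexpanded S′ z
    t′ = totalDeficit S′ z
    ω = weight (depth S z)

  -- the ≥-rule may choose any fresh name, so names not occurring in S must carry no potential
  potential : CS → Var → ℕ
  potential S z with occurs? z S
  ... | yes _ = cost S z
  ... | no _ = 0

  potential-occurs : ∀ {z} → Occurs z S → potential S z ≡ cost S z
  potential-occurs {S} {z} o with occurs? z S
  ... | yes _ = refl
  ... | no ¬o = ⊥-elim (¬o o)

  potential-fresh : ∀ {z} → ¬ Occurs z S → potential S z ≡ 0
  potential-fresh {S} {z} ¬o with occurs? z S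
  ... | yes o = ⊥-elim (¬o o)
  ... | no _ = refl

  potential-mono : ∀ {z} → S ⊆ S′ → (Occurs z S′ → Occurs z S) → depth S′ z ≡ depth S z →
    potential S′ z ≤ potential S z
  potential-mono {S} {S′} {z} S⊆S′ occurs-back depth≡ with occurs? z S′ | occurs? z S
  ... | no _ | _ = z≤n
  ... | yes o′ | no ¬o = ⊥-elim (¬o (occurs-back o′))
  ... | yes _ | yes _ = cost-mono S⊆S′ depth≡

  Φ : CS → ℕ
  Φ S = sumBelow (fresh S) (potential S)

  Φ-sumBelow : ∀ S {n} → maxVar S < n → Φ S ≡ sumBelow n (potential S)
  Φ-sumBelow S S<n =
    sym (sumBelow-zeros (λ fresh≤z → potential-fresh {S} λ o → <⇒≱ (s≤s (occurs⇒≤maxVar o)) fresh≤z) S<n)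

  module _ {S S′ : CS} where

    private
      bound : ℕ
      bound = suc (maxVar S ⊔ maxVar S′)

      Φ-via-bound : sumBelow bound (potential S′) < sumBelow bound (potential S) → Φ S′ < Φ S
      Φ-via-bound = subst₂ _<_ (sym (Φ-sumBelow S′ (s≤s (m≤n⊔m (maxVar S) _)))) (sym (Φ-sumBelow S (s≤s (m≤m⊔n _ (maxVar S′)))))

      below-bound : ∀ {z} → Occurs z S ⊎ Occurs z S′ → z < bound
      below-bound (inj₁ o) = s≤s (≤-trans (occurs⇒≤maxVar o) (m≤m⊔n _ _))
      below-bound (inj₂ o) = s≤s (≤-trans (occurs⇒≤maxVar o) (m≤n⊔m _ _))

    Φ-<₁ : ∀ {x} → Occurs x S → (∀ z → z ≢ x → potential S′ z ≤ potential S z) →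
      potential S′ x < potential S x → Φ S′ < Φ S
    Φ-<₁ x∈S elsewhere at-x = Φ-via-bound (sumBelow-<₁ bound (below-bound (inj₁ x∈S)) elsewhere at-x)

    Φ-<₂ : ∀ {x y} → Occurs x S → Occurs y S′ → x ≢ y → (∀ z → z ≢ x → z ≢ y → potential S′ z ≤ potential S z) →
      potential S′ x + potential S′ y < potential S x + potential S y → Φ S′ < Φ S
    Φ-<₂ x∈S y∈S′ x≢y elsewhere at-xy =
      Φ-via-bound (sumBelow-<₂ bound (below-bound (inj₁ x∈S)) (below-bound (inj₂ y∈S′)) x≢y elsewhere at-xy)

  Φ-expansion : ∀ {S x χs χ₀ χ} → (x ⊨c χ₀) ∈ S → (∀ {χ′} → χ′ ∈ χs → md χ′ ≤ md χ₀) →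
    χ ∈ χs → χ ∈ Cl → (x ⊨c χ) ∉ S → Φ (Expansion.expanded x χs S) < Φ S
  Φ-expansion {S} {x} {χs} x⊨χ₀ md≤ χ∈χs χ∈Cl x⊨χ∉S =
    Φ-<₁ {S′ = expanded} x∈S (λ z _ → potential-mono old⊆ (occurs⁻ x∈S) (depth≡ z))
      (subst₂ _<_ (sym (potential-occurs (occurs-⊆ old⊆ x∈S))) (sym (potential-occurs x∈S))
        (cost-<-unexpanded old⊆ (depth≡ x) χ∈Cl x⊨χ∉S (∈-++⁺ˡ (∈-map⁺ (x ⊨c_) χ∈χs))))
    where
    open Expansion x χs S

    x∈S : Occurs x S
    x∈S = ⊨-occurs x⊨χ₀

    old⊆ : S ⊆ expanded
    old⊆ = ∈-++⁺ʳ (map (x ⊨c_) χs)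

    depth≡ : ∀ z → depth expanded z ≡ depth S z
    depth≡ z = depth-≡ old⊆ λ m → case ⊨∈⁻ m of λ
      { (inj₁ (refl , χ′∈χs)) → ≤-trans (md≤ χ′∈χs) (md≤depth x⊨χ₀)
      ; (inj₂ m∈S) → md≤depth m∈S }

  Φ-generation : ∀ {S x R n ψ y ch L} → Invariant S → (x ⊨c (⟨ R ⟩≥ n ∙ ψ)) ∈ S → ¬ AtLeastS S R x ψ n →
    ¬ Occurs y S → (L-shape : Chosen S R x y ch L) →
    Φ (Generation.generated L-shape) < Φ S
  Φ-generation {S} {x} {R} {n} {ψ} {y} {ch} {L} inv x⊨≥ ¬atLeast y-fresh L-shape =
    Φ-<₂ {S′ = generated} x∈S (here (inj₂ refl)) x≢y elsewhere (begin-strict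
      potential generated x + potential generated y    <⟨ +-monoʳ-< _ y-cheap ⟩
      potential generated x + weight (depth S x)       ≤⟨ x-pays ⟩
      potential S x                                    ≤⟨ m≤m+n _ _ ⟩
      potential S x + potential S y                    ∎)
    where
    open Generation L-shape
    open ≤-Reasoning

    x∈S : Occurs x S
    x∈S = ⊨-occurs x⊨≥

    x≢y : x ≢ y
    x≢y = occurs⇒≢ y-fresh x∈S

    old⊆ : S ⊆ generated
    old⊆ = there ∘ there ∘ ∈-++⁺ʳ L

    depth≡ : ∀ {z} → z ≢ y → depth generated z ≡ depth S z
    depth≡ z≢y = depth-≡ old⊆ (md≤depth ∘ agree z≢y)

    elsewhere : ∀ z → z ≢ x → z ≢ y → potential generated z ≤ potential S z
    elsewhere z _ z≢y = potential-mono old⊆ (Sum.[ ⊥-elim ∘ z≢y , (λ o → o) ] ∘ occurs⁻ x∈S) (depth≡ z≢y)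

    deficit< : deficit generated x (⟨ R ⟩≥ n ∙ ψ) < deficit S x (⟨ R ⟩≥ n ∙ ψ)
    deficit< = ≤-<-trans (∸-monoʳ-≤ n (♯-grows y-fresh old⊆ (here refl , there (here refl))))
                         (∸-monoʳ-< (n<1+n _) (≰⇒> (¬atLeast ∘ ≤♯⇒atLeast)))

    x-pays : potential generated x + weight (depth S x) ≤ potential S x
    x-pays rewrite potential-occurs (occurs-⊆ old⊆ x∈S) | potential-occurs x∈S =
      cost-drop old⊆ (depth≡ x≢y) (formulas∈Cl inv x⊨≥) deficit<

    modal-md< : ∀ {ψ′} → InModalSet S R x ψ′ → md ψ′ < depth S x
    modal-md< (_ , inj₁ m) = md≤depth m
    modal-md< (_ , inj₂ m) = md≤depth m

    y-shallower : depth generated y < depth S x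
    y-shallower = depth< (≤-trans (s≤s z≤n) (md≤depth x⊨≥)) λ m → case ⊨∈⁻ m of λ
      { (inj₁ (_ , target)) → md≤depth x⊨≥
      ; (inj₁ (_ , chosen im)) → ≤-<-trans (md-select ch _) (modal-md< im)
      ; (inj₂ m∈S) → ⊥-elim (y-fresh (⊨-occurs m∈S)) }

    y-cheap : potential generated y < weight (depth S x)
    y-cheap rewrite potential-occurs {generated} (here (inj₂ refl)) =
      ≤-<-trans (cost≤costBound generated y) (costBound<weight y-shallower)

  Φ-step : Invariant S → Step S S′ → Φ S′ < Φ S
  Φ-step {S} inv (∧-rule x a b x⊨∧ ¬both) =
    let χ , χ∈ , χ∈Cl , χ∉S = unexpanded-conjunct in Φ-expansion x⊨∧ conjunct-md χ∈ χ∈Cl χ∉S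
    where
    conjunct-md : ∀ {χ} → χ ∈ a ∷ b ∷ [] → md χ ≤ md (a ∧f b)
    conjunct-md (here refl) = m≤m⊔n (md a) (md b)
    conjunct-md (there (here refl)) = m≤n⊔m (md a) (md b)

    unexpanded-conjunct : Σ[ χ ∈ Form ] (χ ∈ a ∷ b ∷ [] × χ ∈ Cl × (x ⊨c χ) ∉ S)
    unexpanded-conjunct with (x ⊨c a) ∈? S
    ... | no a∉ = a , here refl , proj₁ (∧-closed (formulas∈Cl inv x⊨∧)) , a∉
    ... | yes a∈ = b , there (here refl) , proj₂ (∧-closed (formulas∈Cl inv x⊨∧)) , ¬both ∘ (a∈ ,_)
  Φ-step inv (∨-rule x a b χ x⊨∨ a∉ b∉ χ≡) =
    Φ-expansion x⊨∨ disjunct-md (here refl)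
      (≡-either (_∈ Cl) χ≡ (proj₁ (∨-closed (formulas∈Cl inv x⊨∨))) (proj₂ (∨-closed (formulas∈Cl inv x⊨∨))))
      (≡-either (λ χ → (x ⊨c χ) ∉ _) χ≡ a∉ b∉)
    where
    disjunct-md : ∀ {χ′} → χ′ ∈ χ ∷ [] → md χ′ ≤ md (a ∨f b)
    disjunct-md (here refl) = ≡-either (λ χ → md χ ≤ md (a ∨f b)) χ≡ (m≤m⊔n (md a) (md b)) (m≤n⊔m (md a) (md b))
  Φ-step inv (≥-rule x R n ψ y ch L x⊨≥ ¬atLeast _ _ y-fresh L-shape _) =
    Φ-generation inv x⊨≥ ¬atLeast y-fresh L-shape

  no-infinite-run : Invariant S → NoInfiniteRun S
  no-infinite-run inv (f , refl , steps) =
    descent∧wf⇒empty descent (On.wellFounded Φ <-wellFounded) (f 0) (0 , refl , inv)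
    where
    descent : Descent (_<_ on Φ) (λ S → ∃[ i ] (f i ≡ S × Invariant S))
    descent (i , refl , inv) = f (suc i) , Φ-step inv (steps i) , suc i , refl , invariant-step inv (steps i)

  ≥-unembeddable : ∀ {S x R n ψ} → Invariant S → (x ⊨c (⟨ R ⟩≥ n ∙ ψ)) ∈ S → ¬ AtLeastS S R x ψ n →
    (∀ {ch} → ch ∈ choices S x R → Unembeddable (≥-child S x R ψ ch)) → Unembeddable S
  ≥-unembeddable {S} {x} {R} {n} {ψ} inv x⊨≥ ¬atLeast children M π emb =
    ¬¬-uncovered π (successors S R x ψ) g g-inj (≰⇒> (¬atLeast ∘ ≤♯⇒atLeast)) λ (i , uncovered) →
    ¬¬-all (modalSet S R x) (λ {ψ′} _ → ∼-complete M (g i) ψ′) λ decided →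
    let ch , ch∈ , agrees = boolFunctions-complete _≟ᶠ_ (λ ψ′ b → M , g i ⊨ select (λ _ → b) ψ′) (modalSet S R x)
                              (λ ψ′∈ → Sum.[ (true ,_) , (false ,_) ] (decided ψ′∈))
    in children ch∈ M (π [ fresh S ↦ g i ])
         (embedding-generation chosen-shape emb (⊨-occurs x⊨≥) fresh-∉ (g i) (proj₁ (g-succ i))
           (λ { target → proj₂ (g-succ i) ; (chosen im) → agrees (modalSet⁺ im) })
           (distinct i uncovered))
    where
    g : Fin n → W M
    g = proj₁ (sat emb x⊨≥)

    g-inj : Injective _≡_ _≡_ g
    g-inj = proj₁ (proj₂ (sat emb x⊨≥))

    g-succ : ∀ i → acc M R (π x) (g i) × M , g i ⊨ ψ
    g-succ = proj₂ (proj₂ (sat emb x⊨≥))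

    distinct : ∀ i → (∀ {u} → u ∈ successors S R x ψ → π u ≢ g i) → ∀ {z} → rel R x z ∈ S → π z ≢ g i
    distinct i uncovered r πz≡gi with successors-decide inv r (n , inj₁ x⊨≥)
    ... | inj₁ z⊨ψ = uncovered (successors⁺ (r , z⊨ψ)) πz≡gi
    ... | inj₂ z⊨∼ψ = ∼-sound M (g i) ψ (subst (λ w → M , w ⊨ (∼ ψ)) πz≡gi (sat emb z⊨∼ψ)) (proj₂ (g-succ i))

  expand-prop : ∀ {c} → (∀ {S′} → Step S S′ → Outcome S′) → c ∈ S → PropRedex S c → Outcome S
  expand-prop {S} {x ⊨c (a ∧f b)} recurse m (∧-redex ¬both) =
    step-outcome step (λ fail M π emb → fail M π (embedding-expansion emb λ
      { (here refl) → proj₁ (sat emb m) ; (there (here refl)) → proj₂ (sat emb m) })) (recurse step)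
    where
    step : Step S ((x ⊨c a) ∷ (x ⊨c b) ∷ S)
    step = ∧-rule x a b m ¬both
  expand-prop {S} {x ⊨c (a ∨f b)} recurse m (∨-redex a∉ b∉) =
    branch-outcome left right
      (λ fail-a fail-b M π emb → Sum.[ (λ a⁺ → fail-a M π (embedding-expansion emb λ { (here refl) → a⁺ }))
                                     , (λ b⁺ → fail-b M π (embedding-expansion emb λ { (here refl) → b⁺ })) ] (sat emb m))
      (recurse left) (recurse right)
    where
    left : Step S ((x ⊨c a) ∷ S)
    left = ∨-rule x a b a m a∉ b∉ (inj₁ refl)

    right : Step S ((x ⊨c b) ∷ S)
    right = ∨-rule x a b b m a∉ b∉ (inj₂ refl)

  expand-≥ : ∀ {c} → Invariant S → (∀ {S′} → Step S S′ → Outcome S′) → (∀ {x} → Saturated S x) →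
    c ∈ S → ≥-Redex S c → Outcome S
  expand-≥ {S} {x ⊨c (⟨ R ⟩≥ n ∙ ψ)} inv recurse saturated m (≥-redex ¬atLeast)
    with any-or-all (λ ch → recurse (≥-step ch m ¬atLeast saturated)) (choices S x R)
  ... | inj₁ some = let ch , _ , success = find some in inj₁ (success-◅ (≥-step ch m ¬atLeast saturated) success)
  ... | inj₂ all = inj₂ (≥-unembeddable inv m ¬atLeast (All.lookup all))

  explore : Invariant S → (∀ {S′} → Step S S′ → Outcome S′) → Outcome S
  explore {S} inv recurse with any? (propRedex? S) S
  ... | yes redex = let _ , c∈S , r = find redex in expand-prop recurse c∈S r
  ... | no ¬prop with any? (≥-redex? S) S
  ...   | yes redex = let _ , c∈S , r = find redex in expand-≥ inv recurse (no-redex⇒saturated ¬prop) c∈S r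
  ...   | no ¬≥ with any? (clashing? S) S
  ...     | yes clashing = inj₂ (clashing⇒unembeddable clashing)
  ...     | no ¬clashing = inj₁ (S , ε , no-redex⇒complete ¬prop ¬≥ , no-clashing⇒clash-free ¬clashing)

  invariant-run : Invariant S → Step* S S′ → Invariant S′
  invariant-run inv ε = inv
  invariant-run inv (step ◅ run) = invariant-run (invariant-step inv step) run

  initial-invariant : ∀ φ → φ ∈ Cl → Invariant (initial φ)
  initial-invariant φ φ∈Cl = record
    { formulas∈Cl = λ { (here refl) → φ∈Cl }
    ; successors-decide = λ { (here ()) }
    ; sources-saturated = λ { (here ()) }
    }

  search : Invariant S → Acc _<_ (Φ S) → Outcome S
  search inv (acc-intro rs) = explore inv λ step → search (invariant-step inv step) (rs (Φ-step inv step))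

corollary2 : (φ : Form) →
    NoInfiniteRun (initial φ) ×
    ((Satisfiable φ → Σ[ S ∈ CS ] (Step* (initial φ) S × Complete S × ClashFree S)) ×
     (Σ[ S ∈ CS ] (Step* (initial φ) S × Complete S × ClashFree S) → Satisfiable φ))
corollary2 φ = no-infinite-run initial-inv , completeness , soundness
  where
  open Tableau (closure φ) (closure-closed φ)

  initial-inv : Invariant (initial φ)
  initial-inv = initial-invariant φ ∈-closure

  completeness : Satisfiable φ → Success (initial φ)
  completeness (M , w , w⊨φ) with search initial-inv (<-wellFounded _)
  ... | inj₁ success = success
  ... | inj₂ unembeddable = ⊥-elim (unembeddable M (λ _ → w) (initial-embedding w⊨φ))

  soundness : Success (initial φ) → Satisfiable φ
  soundness (S , run , complete , clash-free) =
    model , x₀ , proj₁ (truth φ) (run-⊆ run (here refl))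
    where open Canonical S complete clash-free (Invariant.successors-decide (invariant-run initial-inv run))
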